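{- Let $n\ge4$ and $\widetilde{W}$ the affine Weyl group of type $\widetilde{D}_n$, with colored segments $\sigma^y_1(j)$, $\sigma^z_0(k)$ as in the context. For $1\le j,k\le 2n-2$ and admissible colors $y,z$, the product $\sigma_1^y(j)\sigma_0^z(k)$ lies in $\widetilde{W}^S$ and has length $j+k$ if and only if ($1\le j<k\le 2n-2$ or $n-1\le j=k\le 2n-2$) and, in the case $j=k=n-1$, $y=z$.
   Context: $\widetilde{W}$ is the Coxeter group with generators $s_0,\dots,s_n$ where $m=3$ for the pairs $(s_0,s_2)$, $(s_1,s_2)$, $(s_i,s_{i+1})$ for $2\le i\le n-2$, and $(s_{n-2},s_n)$; all other pairs commute. $S=\{s_1,\dots,s_n\}$ and $\widetilde{W}^S$ is the set of minimal length left coset representatives of $W_S$. Colors $z\in\{b,c\}$ matter only for length $n-1$. 1-segments: $\sigma_1(j)=s_j\cdots s_2s_1$ for $1\le j\le n-2$; $\sigma_1^b(n-1)=s_{n-1}s_{n-2}\cdots s_2s_1$; $\sigma_1^c(n-1)=s_ns_{n-2}\cdots s_2s_1$; $\sigma_1(j)=s_{2n-j-1}\cdots s_{n-2}s_{n-1}s_ns_{n-2}\cdots s_3s_2s_1$ for $n\le j\le 2n-2$. The 0-segment $\sigma^z_0(j)$ is obtained from the word $\sigma^z_1(j)$ by interchanging $s_0\leftrightarrow s_1$ and $s_{n-1}\leftrightarrow s_n$ (e.g. $\sigma^b_0(n-1)=s_ns_{n-2}\cdots s_2s_0$). For lengths other than $n-1$ the color superscript is irrelevant. -}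

module Defs where

open import Data.Nat using (ℕ; zero; suc; _+_; _∸_; _*_; _≤_; _<_; _≟_; _≤?_)
open import Data.List using (List; []; _∷_; _++_; map; length)
open import Data.List.Relation.Unary.All using (All)
open import Data.Product using (Σ; _×_)
open import Data.Sum using (_⊎_)
open import Relation.Binary.PropositionalEquality using (_≡_; _≢_)
open import Relation.Nullary using (¬_; yes; no)

-- Words in the generators s_0,…,s_n; the letter i stands for s_i.
Word : Set
Word = List ℕ

-- Edges (m = 3) of the Coxeter diagram of type D̃_n (n ≥ 4).
data Edge (n : ℕ) : ℕ → ℕ → Set where
  e02  : Edge n 0 2
  e12  : Edge n 1 2
  eii  : ∀ {i} → 2 ≤ i → i + 2 ≤ n → Edge n i (suc i)
  en   : Edge n (n ∸ 2) n

Adj : ℕ → ℕ → ℕ → Set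
Adj n i j = Edge n i j ⊎ Edge n j i

data Rel (n : ℕ) : Word → Word → Set where
  square : ∀ {i} → i ≤ n → Rel n (i ∷ i ∷ []) []
  comm   : ∀ {i j} → i ≤ n → j ≤ n → i ≢ j → ¬ Adj n i j →
           Rel n (i ∷ j ∷ []) (j ∷ i ∷ [])
  braid  : ∀ {i j} → Adj n i j → Rel n (i ∷ j ∷ i ∷ []) (j ∷ i ∷ j ∷ [])

data _≈W[_]_ : Word → ℕ → Word → Set where
  step  : ∀ {n a b} (u v : Word) → Rel n a b → (u ++ a ++ v) ≈W[ n ] (u ++ b ++ v)
  ≈refl : ∀ {n w} → w ≈W[ n ] w
  ≈sym  : ∀ {n v w} → v ≈W[ n ] w → w ≈W[ n ] v
  ≈trans : ∀ {n u v w} → u ≈W[ n ] v → v ≈W[ n ] w → u ≈W[ n ] w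

HasLength : ℕ → Word → ℕ → Set
HasLength n w m =
  Σ Word (λ v → (v ≈W[ n ] w) × (length v ≡ m)) ×
  (∀ v → v ≈W[ n ] w → m ≤ length v)

LenLe : ℕ → Word → ℕ → Set
LenLe n w m = Σ Word (λ v → (v ≈W[ n ] w) × (length v ≤ m))

InS : ℕ → ℕ → Set
InS n i = (1 ≤ i) × (i ≤ n)

-- w ∈ W̃^S : w has minimal length in its left coset w W_S.
InWS : ℕ → Word → Set
InWS n w = ∀ (u : Word) → All (InS n) u → ∀ v → v ≈W[ n ] (w ++ u) → LenLe n w (length v)

data Color : Set where
  b c : Color

down : ℕ → Word
down zero = []
down (suc k) = suc k ∷ down k

up : ℕ → ℕ → Word
up a zero = []
up a (suc m) = a ∷ up (suc a) m

-- σ^b_1(n-1) and σ^c_1(n-1)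
col : ℕ → Color → Word
col n b = (n ∸ 1) ∷ down (n ∸ 2)
col n c = n ∷ down (n ∸ 2)

-- 1-segments σ^y_1(j) (colour only used when j = n-1)
σ₁ : ℕ → ℕ → Color → Word
σ₁ n j y with j ≤? n ∸ 2
... | yes _ = down j
... | no _ with j ≟ n ∸ 1
...   | yes _ = col n y
...   | no _ = up (2 * n ∸ j ∸ 1) (j ∸ n) ++ ((n ∸ 1) ∷ n ∷ down (n ∸ 2))

τ : ℕ → ℕ → ℕ
τ n 0 = 1
τ n 1 = 0
τ n i with i ≟ n ∸ 1
... | yes _ = n
... | no _ with i ≟ n
...   | yes _ = n ∸ 1
...   | no _ = i

σ₀ : ℕ → ℕ → Color → Word
σ₀ n j z = map (τ n) (σ₁ n j z)

module Submission where

-- Write n = e + 4 and d = n - 2.  The group W̃ acts on ℤⁿ by affine maps: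
-- s₀ : (x₁,x₂) ↦ (1-x₂, 1-x₁),  sᵢ (1 ≤ i < n) exchanges xᵢ and xᵢ₊₁, and
-- sₙ : (xₙ₋₁,xₙ) ↦ (-xₙ, -xₙ₋₁).  For q ∈ ℤⁿ let  depth q  count, over all pairs
-- i < j and both signs, the integers strictly between qᵢ ± qⱼ and the open
-- interval (0,1): the affine walls separating q from the fundamental alcove.
--
-- (1) Every generator changes depth by at most one and the letters of S fix the
--     origin 0, so  depth (w·0) ≤ ℓ(w)  and  depth (wu·0) = depth (w·0)  for u ∈ W_S.
--     Hence a word w with  depth (w·0) = length w  is reduced and lies in W̃^S.
-- (2) When the condition on (j, k, y, z) holds we compute the points σ₀ᶻ(k)·0 and
--     σ₁ʸ(j)σ₀ᶻ(k)·0 explicitly and find depth j + k.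
-- (3) When the condition fails, w = σ₁ʸ(j)σ₀ᶻ(k) ends with s₀, and braid moves show
--     that w·s₁ has an expression of length j + k - 1, so w cannot be a reduced
--     element of W̃^S of length j + k.

open import Defs renaming (b to cB; c to cC)
open import Data.Nat as ℕ using (ℕ; zero; suc; _≤_; _<_; z≤n; s≤s; _+_; _∸_; _*_; _<?_; _≟_; _≤?_; pred)
open import Data.Nat.Properties as ℕP using (≤-refl; m≤n⇒m≤1+n; n≤1+n; +-suc; +-comm; +-monoˡ-≤; +-monoʳ-≤; ≤-trans; ≤-reflexive; <-cmp)
open import Data.Integer as ℤ using (ℤ; +_; -[1+_]; -_; _-_; 1ℤ) renaming (_+_ to _⊕_)
import Data.Integer.Properties as ℤP
import Data.Integer.Tactic.RingSolver as ZS
import Data.Nat.Tactic.RingSolver as NS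
open import Algebra.Properties.CommutativeSemigroup ℕP.+-commutativeSemigroup using (x∙yz≈y∙xz)
open import Data.List using (List; []; _∷_; _++_; length; replicate; map; take; drop)
open import Data.List.Properties using (++-assoc; length-++; ++-identityʳ; map-++; length-take; take++drop≡id; length-map; take-all)
open import Data.List.Relation.Unary.All using (All; []; _∷_)
open import Data.List.Relation.Unary.All.Properties using (take⁺; ++⁺)
open import Data.Product using (Σ; _×_; _,_; proj₁; proj₂)
open import Data.Sum using (_⊎_; inj₁; inj₂; [_,_]′)
open import Data.Empty using (⊥; ⊥-elim)
open import Function.Bundles using (_⇔_; mk⇔)
open import Relation.Nullary using (¬_; yes; no)
open import Relation.Binary.PropositionalEquality
open import Relation.Binary.Definitions using (tri<; tri≈; tri>)

-- The number of integers strictly between t and a point of the open interval (0,1):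
-- t - 1 for t ≥ 1 and -t for t ≤ 0.
wallCount : ℤ → ℕ
wallCount (+ zero) = 0
wallCount (+ suc m) = m
wallCount -[1+ m ] = suc m

-- Reflecting a value through 0, 1/2 or 1 moves it past at most one integer.
wallCount-neg≤ : ∀ t → wallCount (- t) ≤ suc (wallCount t)
wallCount-neg≤ (+ zero) = z≤n
wallCount-neg≤ (+ suc m) = ≤-refl
wallCount-neg≤ -[1+ m ] = m≤n⇒m≤1+n (n≤1+n m)

wallCount-1- : ∀ t → wallCount (1ℤ - t) ≡ wallCount t
wallCount-1- (+ zero) = refl
wallCount-1- (+ suc zero) = refl
wallCount-1- (+ suc (suc m)) = refl
wallCount-1- -[1+ m ] = refl

wallCount-2-≤ : ∀ t → wallCount (+ 2 - t) ≤ suc (wallCount t)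
wallCount-2-≤ (+ zero) = s≤s z≤n
wallCount-2-≤ (+ suc zero) = z≤n
wallCount-2-≤ (+ suc (suc zero)) = z≤n
wallCount-2-≤ (+ suc (suc (suc m))) = s≤s (m≤n⇒m≤1+n (n≤1+n m))
wallCount-2-≤ -[1+ m ] = ≤-refl

Exceeds : ℤ → ℤ → Set
Exceeds x y = Σ ℕ (λ m → x - y ≡ + suc m)

NonPos : ℤ → Set
NonPos t = Σ ℕ (λ m → t ≡ - (+ m))

wallCount-neg : ∀ t m → t ≡ + suc m → wallCount (- t) ≡ suc (wallCount t)
wallCount-neg t m refl = refl

wallCount-2- : ∀ t → NonPos t → wallCount (+ 2 - t) ≡ suc (wallCount t)
wallCount-2- t (zero , refl) = refl
wallCount-2- t (suc m , refl) = refl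

-- The generators act on two consecutive coordinates through one of three maps.
PairMap : Set
PairMap = ℤ → ℤ → ℤ × ℤ

exchange reflect₀ reflectₙ : PairMap
exchange x y = y , x
reflect₀ x y = 1ℤ - y , 1ℤ - x
reflectₙ x y = - y , - x

-- applyAt p f q  applies f to the coordinates p and p+1 of q (counting from 0).
applyAt : ℕ → PairMap → List ℤ → List ℤ
applyAt zero f (x ∷ y ∷ r) = proj₁ (f x y) ∷ proj₂ (f x y) ∷ r
applyAt zero f (x ∷ []) = x ∷ []
applyAt zero f [] = []
applyAt (suc p) f [] = []
applyAt (suc p) f (x ∷ r) = x ∷ applyAt p f r

-- Walls x ± y = m separating a pair of coordinates from the alcove, and their totals.
pairWalls : ℤ → ℤ → ℕ
pairWalls x y = wallCount (x - y) + wallCount (x ⊕ y)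

rowWalls : ℤ → List ℤ → ℕ
rowWalls x [] = 0
rowWalls x (y ∷ ys) = pairWalls x y + rowWalls x ys

depth : List ℤ → ℕ
depth [] = 0
depth (x ∷ xs) = rowWalls x xs + depth xs

+-leftComm : ∀ a b c → a + (b + c) ≡ b + (a + c)
+-leftComm = x∙yz≈y∙xz

neg-diff : ∀ x y → y - x ≡ - (x - y)
neg-diff = ZS.solve-∀

pairWalls-exchange≤ : ∀ x y → pairWalls y x ≤ suc (pairWalls x y)
pairWalls-exchange≤ x y rewrite neg-diff x y | ℤP.+-comm y x = +-monoˡ-≤ (wallCount (x ⊕ y)) (wallCount-neg≤ (x - y))

pairWalls-exchange : ∀ x y → Exceeds x y → pairWalls y x ≡ suc (pairWalls x y)
pairWalls-exchange x y (m , e) rewrite neg-diff x y | ℤP.+-comm y x | wallCount-neg (x - y) m e = refl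

minus-neg : ∀ z y → z - (- y) ≡ z ⊕ y
minus-neg = ZS.solve-∀

pairWalls-neg : ∀ z y → pairWalls z (- y) ≡ pairWalls z y
pairWalls-neg z y rewrite minus-neg z y = +-comm (wallCount (z ⊕ y)) (wallCount (z - y))

reflectₙ-diff : ∀ a b → (- b) - (- a) ≡ a - b
reflectₙ-diff = ZS.solve-∀

reflectₙ-sum : ∀ a b → (- b) ⊕ (- a) ≡ - (a ⊕ b)
reflectₙ-sum = ZS.solve-∀

pairWalls-reflectₙ≤ : ∀ a b → pairWalls (- b) (- a) ≤ suc (pairWalls a b)
pairWalls-reflectₙ≤ a b rewrite reflectₙ-diff a b | reflectₙ-sum a b | sym (+-suc (wallCount (a - b)) (wallCount (a ⊕ b))) =
  +-monoʳ-≤ (wallCount (a - b)) (wallCount-neg≤ (a ⊕ b))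

pairWalls-reflectₙ : ∀ a b m → a ⊕ b ≡ + suc m → pairWalls (- b) (- a) ≡ suc (pairWalls a b)
pairWalls-reflectₙ a b m e rewrite reflectₙ-diff a b | reflectₙ-sum a b | sym (+-suc (wallCount (a - b)) (wallCount (a ⊕ b))) | wallCount-neg (a ⊕ b) m e = refl

reflect₀-row-diff : ∀ y z → (1ℤ - y) - z ≡ 1ℤ - (y ⊕ z)
reflect₀-row-diff = ZS.solve-∀

reflect₀-row-sum : ∀ y z → (1ℤ - y) ⊕ z ≡ 1ℤ - (y - z)
reflect₀-row-sum = ZS.solve-∀

pairWalls-1- : ∀ y z → pairWalls (1ℤ - y) z ≡ pairWalls y z
pairWalls-1- y z rewrite reflect₀-row-diff y z | reflect₀-row-sum y z | wallCount-1- (y ⊕ z) | wallCount-1- (y - z) =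
  +-comm (wallCount (y ⊕ z)) (wallCount (y - z))

reflect₀-diff : ∀ x y → (1ℤ - y) - (1ℤ - x) ≡ x - y
reflect₀-diff = ZS.solve-∀

reflect₀-sum : ∀ x y → (1ℤ - y) ⊕ (1ℤ - x) ≡ + 2 - (x ⊕ y)
reflect₀-sum = ZS.solve-∀

pairWalls-reflect₀≤ : ∀ x y → pairWalls (1ℤ - y) (1ℤ - x) ≤ suc (pairWalls x y)
pairWalls-reflect₀≤ x y rewrite reflect₀-diff x y | reflect₀-sum x y | sym (+-suc (wallCount (x - y)) (wallCount (x ⊕ y))) =
  +-monoʳ-≤ (wallCount (x - y)) (wallCount-2-≤ (x ⊕ y))

pairWalls-reflect₀ : ∀ x y → NonPos (x ⊕ y) → pairWalls (1ℤ - y) (1ℤ - x) ≡ suc (pairWalls x y)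
pairWalls-reflect₀ x y np rewrite reflect₀-diff x y | reflect₀-sum x y | sym (+-suc (wallCount (x - y)) (wallCount (x ⊕ y))) | wallCount-2- (x ⊕ y) np = refl

-- Lifting the pair estimates to depth: only the walls of the two moved
-- coordinates against each other change; the rows against the others are permuted.
+-assoc₄ : ∀ a b c d → (a + b) + (c + d) ≡ a + (b + (c + d))
+-assoc₄ = NS.solve-∀

depth-cons₂ : ∀ x y r → depth (x ∷ y ∷ r) ≡ pairWalls x y + (rowWalls x r + (rowWalls y r + depth r))
depth-cons₂ x y r = +-assoc₄ (pairWalls x y) (rowWalls x r) (rowWalls y r) (depth r)

depth-cons₂-exchanged : ∀ x y r → depth (y ∷ x ∷ r) ≡ pairWalls y x + (rowWalls x r + (rowWalls y r + depth r))
depth-cons₂-exchanged x y r = trans (+-assoc₄ (pairWalls y x) (rowWalls y r) (rowWalls x r) (depth r))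
  (cong (λ t → pairWalls y x + t) (+-leftComm (rowWalls y r) (rowWalls x r) (depth r)))

rowWalls-exchange : ∀ z A x y B → rowWalls z (A ++ y ∷ x ∷ B) ≡ rowWalls z (A ++ x ∷ y ∷ B)
rowWalls-exchange z [] x y B = +-leftComm (pairWalls z y) (pairWalls z x) (rowWalls z B)
rowWalls-exchange z (a ∷ A) x y B = cong (λ t → pairWalls z a + t) (rowWalls-exchange z A x y B)

rowWalls-applyAt-exchange : ∀ z p r → rowWalls z (applyAt p exchange r) ≡ rowWalls z r
rowWalls-applyAt-exchange z zero [] = refl
rowWalls-applyAt-exchange z zero (x ∷ []) = refl
rowWalls-applyAt-exchange z zero (x ∷ y ∷ r) = +-leftComm (pairWalls z y) (pairWalls z x) (rowWalls z r)
rowWalls-applyAt-exchange z (suc p) [] = refl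
rowWalls-applyAt-exchange z (suc p) (x ∷ r) = cong (λ t → pairWalls z x + t) (rowWalls-applyAt-exchange z p r)

-- The walls between -y and -x and the other coordinates are those of x and y
-- (the rows see both signs); reflectₙ only ever acts on the last two coordinates.
rowWalls-applyAt-reflectₙ : ∀ z p r → length r ≡ suc (suc p) → rowWalls z (applyAt p reflectₙ r) ≡ rowWalls z r
rowWalls-applyAt-reflectₙ z zero (a ∷ b ∷ []) e rewrite pairWalls-neg z b | pairWalls-neg z a = +-leftComm (pairWalls z b) (pairWalls z a) 0
rowWalls-applyAt-reflectₙ z (suc p) (x ∷ r) e = cong (λ t → pairWalls z x + t) (rowWalls-applyAt-reflectₙ z p r (ℕP.suc-injective e))

rowWalls-reflectₙ-end : ∀ z A a b → rowWalls z (A ++ - b ∷ - a ∷ []) ≡ rowWalls z (A ++ a ∷ b ∷ [])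
rowWalls-reflectₙ-end z [] a b rewrite pairWalls-neg z b | pairWalls-neg z a = +-leftComm (pairWalls z b) (pairWalls z a) 0
rowWalls-reflectₙ-end z (c ∷ A) a b = cong (λ t → pairWalls z c + t) (rowWalls-reflectₙ-end z A a b)

rowWalls-1- : ∀ y r → rowWalls (1ℤ - y) r ≡ rowWalls y r
rowWalls-1- y [] = refl
rowWalls-1- y (z ∷ r) = cong₂ _+_ (pairWalls-1- y z) (rowWalls-1- y r)

+-mono-suc : ∀ a b c → b ≤ suc c → a + b ≤ suc (a + c)
+-mono-suc a b c le = ≤-trans (+-monoʳ-≤ a le) (≤-reflexive (+-suc a c))

depth-exchange≤ : ∀ p q → depth (applyAt p exchange q) ≤ suc (depth q)
depth-exchange≤ zero [] = z≤n
depth-exchange≤ zero (x ∷ []) = n≤1+n _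
depth-exchange≤ zero (x ∷ y ∷ r) rewrite depth-cons₂-exchanged x y r | depth-cons₂ x y r = +-monoˡ-≤ _ (pairWalls-exchange≤ x y)
depth-exchange≤ (suc p) [] = z≤n
depth-exchange≤ (suc p) (x ∷ r) rewrite rowWalls-applyAt-exchange x p r = +-mono-suc (rowWalls x r) _ _ (depth-exchange≤ p r)

depth-reflectₙ≤ : ∀ p q → length q ≡ suc (suc p) → depth (applyAt p reflectₙ q) ≤ suc (depth q)
depth-reflectₙ≤ zero (a ∷ b ∷ []) e = +-monoˡ-≤ 0 (+-monoˡ-≤ 0 (pairWalls-reflectₙ≤ a b))
depth-reflectₙ≤ (suc p) (x ∷ r) e rewrite rowWalls-applyAt-reflectₙ x p r (ℕP.suc-injective e) =
  +-mono-suc (rowWalls x r) _ _ (depth-reflectₙ≤ p r (ℕP.suc-injective e))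

depth-reflect₀≤ : ∀ q → depth (applyAt 0 reflect₀ q) ≤ suc (depth q)
depth-reflect₀≤ [] = z≤n
depth-reflect₀≤ (x ∷ []) = n≤1+n _
depth-reflect₀≤ (x ∷ y ∷ r)
  rewrite depth-cons₂ (1ℤ - y) (1ℤ - x) r | rowWalls-1- y r | rowWalls-1- x r | depth-cons₂ x y r | +-leftComm (rowWalls x r) (rowWalls y r) (depth r) =
  +-monoˡ-≤ _ (pairWalls-reflect₀≤ x y)

depth-exchange : ∀ A x y B → Exceeds x y → depth (A ++ y ∷ x ∷ B) ≡ suc (depth (A ++ x ∷ y ∷ B))
depth-exchange [] x y B gt rewrite depth-cons₂-exchanged x y B | depth-cons₂ x y B | pairWalls-exchange x y gt = refl
depth-exchange (a ∷ A) x y B gt rewrite rowWalls-exchange a A x y B | depth-exchange A x y B gt = +-suc _ _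

depth-reflectₙ : ∀ A a b m → a ⊕ b ≡ + suc m → depth (A ++ - b ∷ - a ∷ []) ≡ suc (depth (A ++ a ∷ b ∷ []))
depth-reflectₙ [] a b m e rewrite pairWalls-reflectₙ a b m e = refl
depth-reflectₙ (c ∷ A) a b m e rewrite rowWalls-reflectₙ-end c A a b | depth-reflectₙ A a b m e = +-suc _ _

depth-reflect₀ : ∀ x y r → NonPos (x ⊕ y) → depth ((1ℤ - y) ∷ (1ℤ - x) ∷ r) ≡ suc (depth (x ∷ y ∷ r))
depth-reflect₀ x y r np
  rewrite depth-cons₂ (1ℤ - y) (1ℤ - x) r | rowWalls-1- y r | rowWalls-1- x r | depth-cons₂ x y r | +-leftComm (rowWalls x r) (rowWalls y r) (depth r) | pairWalls-reflect₀ x y np = refl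

applyAt-++ : ∀ A x y B f → applyAt (length A) f (A ++ x ∷ y ∷ B) ≡ A ++ proj₁ (f x y) ∷ proj₂ (f x y) ∷ B
applyAt-++ [] x y B f = refl
applyAt-++ (a ∷ A) x y B f = cong (a ∷_) (applyAt-++ A x y B f)

length-applyAt : ∀ p f q → length (applyAt p f q) ≡ length q
length-applyAt zero f [] = refl
length-applyAt zero f (x ∷ []) = refl
length-applyAt zero f (x ∷ y ∷ r) = refl
length-applyAt (suc p) f [] = refl
length-applyAt (suc p) f (x ∷ r) = cong suc (length-applyAt p f r)

PairInvolution : PairMap → Set
PairInvolution f = ∀ x y → f (proj₁ (f x y)) (proj₂ (f x y)) ≡ (x , y)

applyAt-involution : ∀ f → PairInvolution f → ∀ p q → applyAt p f (applyAt p f q) ≡ q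
applyAt-involution f inv zero [] = refl
applyAt-involution f inv zero (x ∷ []) = refl
applyAt-involution f inv zero (x ∷ y ∷ r) = cong (λ pr → proj₁ pr ∷ proj₂ pr ∷ r) (inv x y)
applyAt-involution f inv (suc p) [] = refl
applyAt-involution f inv (suc p) (x ∷ r) = cong (x ∷_) (applyAt-involution f inv p r)

1-1- : ∀ x → 1ℤ - (1ℤ - x) ≡ x
1-1- = ZS.solve-∀

exchange-involution : PairInvolution exchange
exchange-involution x y = refl

reflect₀-involution : PairInvolution reflect₀
reflect₀-involution x y rewrite 1-1- x | 1-1- y = refl

reflectₙ-involution : PairInvolution reflectₙ
reflectₙ-involution x y rewrite ℤP.neg-involutive x | ℤP.neg-involutive y = refl

applyAt-far-commute : ∀ p p' f f' q → suc p < p' → applyAt p f (applyAt p' f' q) ≡ applyAt p' f' (applyAt p f q)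
applyAt-far-commute zero (suc zero) f f' q (s≤s ())
applyAt-far-commute zero (suc (suc p')) f f' [] lt = refl
applyAt-far-commute zero (suc (suc p')) f f' (x ∷ []) lt = refl
applyAt-far-commute zero (suc (suc p')) f f' (x ∷ y ∷ r) lt = refl
applyAt-far-commute (suc p) (suc p') f f' [] lt = refl
applyAt-far-commute (suc p) (suc p') f f' (x ∷ r) (s≤s lt) = cong (x ∷_) (applyAt-far-commute p p' f f' r lt)

PairCommute : PairMap → PairMap → Set
PairCommute f f' = ∀ x y → f (proj₁ (f' x y)) (proj₂ (f' x y)) ≡ f' (proj₁ (f x y)) (proj₂ (f x y))

applyAt-same-commute : ∀ p f f' q → PairCommute f f' → applyAt p f (applyAt p f' q) ≡ applyAt p f' (applyAt p f q)
applyAt-same-commute zero f f' [] commute-rel = refl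
applyAt-same-commute zero f f' (x ∷ []) commute-rel = refl
applyAt-same-commute zero f f' (x ∷ y ∷ r) commute-rel = cong (λ pr → proj₁ pr ∷ proj₂ pr ∷ r) (commute-rel x y)
applyAt-same-commute (suc p) f f' [] commute-rel = refl
applyAt-same-commute (suc p) f f' (x ∷ r) commute-rel = cong (x ∷_) (applyAt-same-commute p f f' r commute-rel)

commute-reflect₀-exchange : PairCommute reflect₀ exchange
commute-reflect₀-exchange x y = refl

commute-exchange-reflectₙ : PairCommute exchange reflectₙ
commute-exchange-reflectₙ x y = refl

PairBraid : PairMap → PairMap → Set
PairBraid f f' = ∀ x y z r → applyAt 0 f (applyAt 1 f' (applyAt 0 f (x ∷ y ∷ z ∷ r))) ≡ applyAt 1 f' (applyAt 0 f (applyAt 1 f' (x ∷ y ∷ z ∷ r)))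

applyAt-braid : ∀ p f f' q → PairBraid f f' → suc (suc (suc p)) ≤ length q →
  applyAt p f (applyAt (suc p) f' (applyAt p f q)) ≡ applyAt (suc p) f' (applyAt p f (applyAt (suc p) f' q))
applyAt-braid zero f f' (x ∷ []) b (s≤s ())
applyAt-braid zero f f' (x ∷ y ∷ []) b (s≤s (s≤s ()))
applyAt-braid zero f f' (x ∷ y ∷ z ∷ r) b le = b x y z r
applyAt-braid (suc p) f f' (x ∷ r) b (s≤s le) = cong (x ∷_) (applyAt-braid p f f' r b le)

braid-reflect₀-exchange : PairBraid reflect₀ exchange
braid-reflect₀-exchange x y z r rewrite 1-1- y = refl

braid-exchange-exchange : PairBraid exchange exchange
braid-exchange-exchange x y z r = refl

braid-exchange-reflectₙ : PairBraid exchange reflectₙ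
braid-exchange-reflectₙ x y z r rewrite ℤP.neg-involutive y = refl

-- The action of the generator sᵢ of W̃ (type D̃ with n coordinates) on ℤⁿ;
-- letters beyond n act trivially.
generator : ℕ → ℕ → List ℤ → List ℤ
generator n zero = applyAt 0 reflect₀
generator n (suc i) with suc i <? n
... | yes _ = applyAt i exchange
... | no _ with suc i ≟ n
...   | yes _ = applyAt (n ∸ 2) reflectₙ
...   | no _ = λ q → q

act : ℕ → Word → List ℤ → List ℤ
act n [] q = q
act n (i ∷ w) q = generator n i (act n w q)

act-++ : ∀ n u v q → act n (u ++ v) q ≡ act n u (act n v q)
act-++ n [] v q = refl
act-++ n (i ∷ u) v q = cong (generator n i) (act-++ n u v q)

generator-exchange : ∀ n i q → suc i < n → generator n (suc i) q ≡ applyAt i exchange q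
generator-exchange n i q lt with suc i <? n
... | yes _ = refl
... | no ¬lt = ⊥-elim (¬lt lt)

generator-top : ∀ n q → generator (suc n) (suc n) q ≡ applyAt (suc n ∸ 2) reflectₙ q
generator-top n q with suc n <? suc n
... | yes lt = ⊥-elim (ℕP.n≮n _ lt)
... | no _ with suc n ≟ suc n
...   | yes _ = refl
...   | no ne = ⊥-elim (ne refl)

generator-outside : ∀ n i q → n < i → generator n i q ≡ q
generator-outside n (suc i) q lt with suc i <? n
... | yes lt' = ⊥-elim (ℕP.<-asym lt lt')
... | no _ with suc i ≟ n
...   | yes e = ⊥-elim (ℕP.<-irrefl (sym e) lt)
...   | no _ = refl

length-generator : ∀ n i q → length (generator n i q) ≡ length q
length-generator n zero q = length-applyAt 0 reflect₀ q
length-generator n (suc i) q with suc i <? n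
... | yes _ = length-applyAt i exchange q
... | no _ with suc i ≟ n
...   | yes _ = length-applyAt (n ∸ 2) reflectₙ q
...   | no _ = refl

length-act : ∀ n w q → length (act n w q) ≡ length q
length-act n [] q = refl
length-act n (i ∷ w) q = trans (length-generator n i (act n w q)) (length-act n w q)

edge-cases : ∀ {N i j} → Edge N i j → (i ≡ 0 × j ≡ 2) ⊎ (i ≡ 1 × j ≡ 2) ⊎ (2 ≤ i × i + 2 ≤ N × j ≡ suc i) ⊎ (i ≡ N ∸ 2 × j ≡ N)
edge-cases e02 = inj₁ (refl , refl)
edge-cases e12 = inj₂ (inj₁ (refl , refl))
edge-cases (eii p q) = inj₂ (inj₂ (inj₁ (p , q , refl)))
edge-cases en = inj₂ (inj₂ (inj₂ (refl , refl)))

length-down : ∀ t → length (down t) ≡ t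
length-down zero = refl
length-down (suc t) = cong suc (length-down t)

length-up : ∀ a t → length (up a t) ≡ t
length-up a zero = refl
length-up a (suc t) = cong suc (length-up (suc a) t)

all-down : ∀ {P : ℕ → Set} k → (∀ w → 1 ≤ w → w ≤ k → P w) → All P (down k)
all-down zero f = []
all-down (suc k) f = f (suc k) (s≤s z≤n) ≤-refl ∷ all-down k (λ w 1w wk → f w 1w (≤-trans wk (n≤1+n k)))

all-up : ∀ {P : ℕ → Set} a t → (∀ w → a ≤ w → w < a + t → P w) → All P (up a t)
all-up a zero f = []
all-up a (suc t) f = f a ≤-refl (subst (a <_) (sym (+-suc a t)) (s≤s (ℕP.m≤m+n a t)))
  ∷ all-up (suc a) t (λ w aw wt → f w (≤-trans (n≤1+n a) aw) (subst (w <_) (sym (+-suc a t)) wt))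

down₂ : ℕ → Word
down₂ t = map suc (down t)

down-split : ∀ t → down (suc t) ≡ down₂ t ++ 1 ∷ []
down-split zero = refl
down-split (suc t) = cong (suc (suc t) ∷_) (down-split t)

up-suc : ∀ a t → up (suc a) t ≡ map suc (up a t)
up-suc a zero = refl
up-suc a (suc t) = cong (suc a ∷_) (up-suc (suc a) t)

up-snoc : ∀ a t → up a (suc t) ≡ up a t ++ (a + t) ∷ []
up-snoc a zero = cong (λ x → x ∷ []) (sym (ℕP.+-identityʳ a))
up-snoc a (suc t) = cong (a ∷_) (trans (up-snoc (suc a) t) (cong (λ x → up (suc a) t ++ x ∷ []) (sym (+-suc a t))))

downVia : (ℕ → ℕ) → ℕ → Word
downVia c zero = []
downVia c (suc k) = c (suc k) ∷ downVia c k

length-downVia : ∀ c k → length (downVia c k) ≡ k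
length-downVia c zero = refl
length-downVia c (suc k) = cong suc (length-downVia c k)

downVia-split : ∀ c r → downVia c (suc r) ≡ downVia (λ i → c (suc i)) r ++ c 1 ∷ []
downVia-split c zero = refl
downVia-split c (suc r) = cong (c (suc (suc r)) ∷_) (downVia-split c r)

downVia-id : ∀ k → downVia (λ i → i) k ≡ down k
downVia-id zero = refl
downVia-id (suc k) = cong (suc k ∷_) (downVia-id k)

-- The symmetric group part: sᵢ (i ≥ 1) exchanges coordinates i-1 and i (from 0).
-- On the letters 1 … n-1 this agrees with the action of W̃ (act≡actSym below).
actSym : Word → List ℤ → List ℤ
actSym [] q = q
actSym (i ∷ w) q = applyAt (pred i) exchange (actSym w q)

actSym-++ : ∀ u v q → actSym (u ++ v) q ≡ actSym u (actSym v q)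
actSym-++ [] v q = refl
actSym-++ (i ∷ u) v q = cong (applyAt (pred i) exchange) (actSym-++ u v q)

actSym-shift : ∀ w a q → All (1 ≤_) w → actSym (map suc w) (a ∷ q) ≡ a ∷ actSym w q
actSym-shift [] a q [] = refl
actSym-shift (suc i ∷ w) a q (s≤s _ ∷ ps) rewrite actSym-shift w a q ps = refl

down-positive : ∀ t → All (1 ≤_) (down t)
down-positive t = all-down t (λ _ 1≤w _ → 1≤w)

up-positive : ∀ a t → 1 ≤ a → All (1 ≤_) (up a t)
up-positive a t 1≤a = all-up a t (λ _ a≤w _ → ≤-trans 1≤a a≤w)

rotate-right : ∀ A x B → actSym (down (length A)) (x ∷ A ++ B) ≡ A ++ x ∷ B
rotate-right [] x B = refl
rotate-right (a ∷ A) x B = begin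
    actSym (down (suc (length A))) (x ∷ a ∷ A ++ B)                       ≡⟨ cong (λ w → actSym w (x ∷ a ∷ A ++ B)) (down-split (length A)) ⟩
    actSym (map suc (down (length A)) ++ 1 ∷ []) (x ∷ a ∷ A ++ B)         ≡⟨ actSym-++ (map suc (down (length A))) (1 ∷ []) (x ∷ a ∷ A ++ B) ⟩
    actSym (map suc (down (length A))) (a ∷ x ∷ A ++ B)                   ≡⟨ actSym-shift (down (length A)) a (x ∷ A ++ B) (down-positive (length A)) ⟩
    a ∷ actSym (down (length A)) (x ∷ A ++ B)                             ≡⟨ cong (a ∷_) (rotate-right A x B) ⟩
    a ∷ A ++ x ∷ B ∎
  where open ≡-Reasoning

rotate-right′ : ∀ A x B t → length A ≡ t → actSym (down t) (x ∷ A ++ B) ≡ A ++ x ∷ B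
rotate-right′ A x B t refl = rotate-right A x B

rotate-left₀ : ∀ A x B → actSym (up 1 (length A)) (A ++ x ∷ B) ≡ x ∷ A ++ B
rotate-left₀ [] x B = refl
rotate-left₀ (a ∷ A) x B
  rewrite up-suc 1 (length A) | actSym-shift (up 1 (length A)) a (A ++ x ∷ B) (up-positive 1 (length A) (s≤s z≤n)) | rotate-left₀ A x B = refl

rotate-left : ∀ C A x B → actSym (up (suc (length C)) (length A)) (C ++ A ++ x ∷ B) ≡ C ++ x ∷ A ++ B
rotate-left [] A x B = rotate-left₀ A x B
rotate-left (c ∷ C) A x B
  rewrite up-suc (suc (length C)) (length A) | actSym-shift (up (suc (length C)) (length A)) c (C ++ A ++ x ∷ B) (up-positive (suc (length C)) (length A) (s≤s z≤n))
        | rotate-left C A x B = refl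

rowWalls-move : ∀ z A x B → rowWalls z (A ++ x ∷ B) ≡ rowWalls z (x ∷ A ++ B)
rowWalls-move z [] x B = refl
rowWalls-move z (a ∷ A) x B rewrite rowWalls-move z A x B = +-leftComm (pairWalls z a) (pairWalls z x) (rowWalls z (A ++ B))

depth-rotate-right : ∀ A x B → All (Exceeds x) A → depth (A ++ x ∷ B) ≡ length A + depth (x ∷ A ++ B)
depth-rotate-right [] x B [] = refl
depth-rotate-right (a ∷ A) x B (p ∷ ps) = begin
    rowWalls a (A ++ x ∷ B) + depth (A ++ x ∷ B)  ≡⟨ cong₂ _+_ (rowWalls-move a A x B) (depth-rotate-right A x B ps) ⟩
    rowWalls a (x ∷ A ++ B) + (length A + depth (x ∷ A ++ B)) ≡⟨ +-leftComm (rowWalls a (x ∷ A ++ B)) (length A) _ ⟩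
    length A + depth (a ∷ x ∷ A ++ B) ≡⟨ cong (λ t → length A + t) (depth-exchange [] x a (A ++ B) p) ⟩
    length A + suc (depth (x ∷ a ∷ A ++ B)) ≡⟨ +-suc (length A) _ ⟩
    suc (length A) + depth (x ∷ a ∷ A ++ B) ∎
  where open ≡-Reasoning

depth-rotate-left₀ : ∀ A x B → All (λ a → Exceeds a x) A → depth (x ∷ A ++ B) ≡ length A + depth (A ++ x ∷ B)
depth-rotate-left₀ [] x B [] = refl
depth-rotate-left₀ (a ∷ A) x B (p ∷ ps) = begin
    depth (x ∷ a ∷ A ++ B) ≡⟨ depth-exchange [] a x (A ++ B) p ⟩
    suc (rowWalls a (x ∷ A ++ B) + depth (x ∷ A ++ B)) ≡⟨ cong suc (cong₂ _+_ (sym (rowWalls-move a A x B)) (depth-rotate-left₀ A x B ps)) ⟩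
    suc (rowWalls a (A ++ x ∷ B) + (length A + depth (A ++ x ∷ B))) ≡⟨ cong suc (+-leftComm (rowWalls a (A ++ x ∷ B)) (length A) _) ⟩
    suc (length A + depth (a ∷ A ++ x ∷ B)) ∎
  where open ≡-Reasoning

rowWalls-move₂ : ∀ z C A x B → rowWalls z (C ++ x ∷ A ++ B) ≡ rowWalls z (C ++ A ++ x ∷ B)
rowWalls-move₂ z C A x B = trans (rowWalls-move z C x (A ++ B)) (trans (cong (rowWalls z) (cong (x ∷_) (sym (++-assoc C A B))))
   (trans (sym (rowWalls-move z (C ++ A) x B)) (cong (rowWalls z) (++-assoc C A (x ∷ B)))))

depth-rotate-left : ∀ C A x B → All (λ a → Exceeds a x) A → depth (C ++ x ∷ A ++ B) ≡ length A + depth (C ++ A ++ x ∷ B)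
depth-rotate-left [] A x B ps = depth-rotate-left₀ A x B ps
depth-rotate-left (c ∷ C) A x B ps = begin
    rowWalls c (C ++ x ∷ A ++ B) + depth (C ++ x ∷ A ++ B) ≡⟨ cong₂ _+_ (rowWalls-move₂ c C A x B) (depth-rotate-left C A x B ps) ⟩
    rowWalls c (C ++ A ++ x ∷ B) + (length A + depth (C ++ A ++ x ∷ B)) ≡⟨ +-leftComm (rowWalls c (C ++ A ++ x ∷ B)) (length A) _ ⟩
    length A + depth (c ∷ C ++ A ++ x ∷ B) ∎
  where open ≡-Reasoning

depth-insert : ∀ x A y B → All (Exceeds y) A → depth (x ∷ A ++ y ∷ B) ≡ length A + depth (x ∷ y ∷ A ++ B)
depth-insert x A y B ps = begin
    rowWalls x (A ++ y ∷ B) + depth (A ++ y ∷ B) ≡⟨ cong₂ _+_ (rowWalls-move x A y B) (depth-rotate-right A y B ps) ⟩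
    rowWalls x (y ∷ A ++ B) + (length A + depth (y ∷ A ++ B)) ≡⟨ +-leftComm (rowWalls x (y ∷ A ++ B)) (length A) _ ⟩
    length A + depth (x ∷ y ∷ A ++ B) ∎
  where open ≡-Reasoning

oneℤ negOneℤ twoℤ zeroℤ : ℤ
oneℤ = + 1
negOneℤ = -[1+ 0 ]
twoℤ = + 2
zeroℤ = + 0

zeros : ℕ → List ℤ
zeros m = replicate m zeroℤ

length-zeros : ∀ m → length (zeros m) ≡ m
length-zeros zero = refl
length-zeros (suc m) = cong suc (length-zeros m)

length-zeros-++ : ∀ m X → length (zeros m ++ X) ≡ m + length X
length-zeros-++ m X = trans (length-++ (zeros m)) (cong (_+ length X) (length-zeros m))

zeros-++ : ∀ a b → zeros (a + b) ≡ zeros a ++ zeros b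
zeros-++ zero b = refl
zeros-++ (suc a) b = cong (zeroℤ ∷_) (zeros-++ a b)

zeros-snoc : ∀ m X → zeros m ++ zeroℤ ∷ X ≡ zeros (suc m) ++ X
zeros-snoc zero X = refl
zeros-snoc (suc m) X = cong (zeroℤ ∷_) (zeros-snoc m X)

all-zeros : ∀ {P : ℤ → Set} m → P zeroℤ → All P (zeros m)
all-zeros zero p = []
all-zeros (suc m) p = p ∷ all-zeros m p

all-take-zeros : ∀ {P : ℤ → Set} j m R → j ≤ m → P zeroℤ → All P (take j (zeros m ++ R))
all-take-zeros zero m R _ p = []
all-take-zeros (suc j) (suc m) R (s≤s le) p = p ∷ all-take-zeros j m R le p

depth-zeros : ∀ m → depth (zeros m) ≡ 0
depth-zeros zero = refl
depth-zeros (suc m) = trans (cong (_+ depth (zeros m)) (rowWalls-origin m)) (depth-zeros m)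
  where
  rowWalls-origin : ∀ m → rowWalls zeroℤ (zeros m) ≡ 0
  rowWalls-origin zero = refl
  rowWalls-origin (suc m) = rowWalls-origin m

exchange-zeros : ∀ p m → applyAt p exchange (zeros m) ≡ zeros m
exchange-zeros zero zero = refl
exchange-zeros zero (suc zero) = refl
exchange-zeros zero (suc (suc m)) = refl
exchange-zeros (suc p) zero = refl
exchange-zeros (suc p) (suc m) = cong (zeroℤ ∷_) (exchange-zeros p m)

reflectₙ-zeros : ∀ p m → applyAt p reflectₙ (zeros m) ≡ zeros m
reflectₙ-zeros zero zero = refl
reflectₙ-zeros zero (suc zero) = refl
reflectₙ-zeros zero (suc (suc m)) = refl
reflectₙ-zeros (suc p) zero = refl
reflectₙ-zeros (suc p) (suc m) = cong (zeroℤ ∷_) (reflectₙ-zeros p m)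

+2-mono : ∀ a b → a ≤ b → a + 2 ≤ suc (suc b)
+2-mono a b le rewrite ℕP.+-comm a 2 = s≤s (s≤s le)

-- Everything below concerns a fixed rank n = e + 4 ≥ 4, with d = n - 2.
module AffineD (e : ℕ) where
  d : ℕ
  d = suc (suc e)

  2≤d : 2 ≤ d
  2≤d = s≤s (s≤s z≤n)

  n : ℕ
  n = suc (suc d)

  data GenView (i : ℕ) : Set where
    view₀ : i ≡ 0 → GenView i
    viewMid : ∀ p → i ≡ suc p → p < suc d → GenView i
    viewTop : i ≡ n → GenView i

  genView : ∀ i → i ≤ n → GenView i
  genView zero _ = view₀ refl
  genView (suc p) (s≤s le) with ℕP.m≤n⇒m<n∨m≡n le
  ... | inj₁ lt = viewMid p refl lt
  ... | inj₂ eq = viewTop (cong suc eq)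

  generator-mid : ∀ p q → p < suc d → generator n (suc p) q ≡ applyAt p exchange q
  generator-mid p q lt = generator-exchange n p q (s≤s lt)

  generator-n : ∀ q → generator n n q ≡ applyAt d reflectₙ q
  generator-n q = generator-top (suc d) q

  viewAction : ∀ {i} → GenView i → List ℤ → List ℤ
  viewAction (view₀ _) = applyAt 0 reflect₀
  viewAction (viewMid p _ _) = applyAt p exchange
  viewAction (viewTop _) = applyAt d reflectₙ

  generator-view : ∀ {i} (si : GenView i) q → generator n i q ≡ viewAction si q
  generator-view (view₀ refl) q = refl
  generator-view (viewMid p refl lt) q = generator-mid p q lt
  generator-view (viewTop refl) q = generator-n q

  generator-view₂ : ∀ {i j} (si : GenView i) (sj : GenView j) q → generator n i (generator n j q) ≡ viewAction si (viewAction sj q)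
  generator-view₂ {j = j} si sj q = trans (generator-view si (generator n j q)) (cong (viewAction si) (generator-view sj q))

  generator-view₃ : ∀ {i j} (si : GenView i) (sj : GenView j) q →
    generator n i (generator n j (generator n i q)) ≡ viewAction si (viewAction sj (viewAction si q))
  generator-view₃ si sj q = trans (generator-view si _) (cong (viewAction si) (generator-view₂ sj si q))

  -- Commutation relations: non-adjacent generators act on disjoint coordinate
  -- pairs, or (s₀,s₁ and s_{n-1},sₙ) on the same pair by commuting pair maps.
  ViewsCommute : ∀ {i j} → GenView i → GenView j → Set
  ViewsCommute si sj = ∀ q → viewAction si (viewAction sj q) ≡ viewAction sj (viewAction si q)

  ViewsCommute-sym : ∀ {i j} {si : GenView i} {sj : GenView j} → ViewsCommute si sj → ViewsCommute sj si
  ViewsCommute-sym commutes q = sym (commutes q)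

  adj-sym : ∀ {i j} → Adj n i j → Adj n j i
  adj-sym (inj₁ edge) = inj₂ edge
  adj-sym (inj₂ edge) = inj₁ edge

  edge-mid : ∀ p → p < d → Edge n (suc p) (suc (suc p))
  edge-mid zero _ = e12
  edge-mid (suc p) lt = eii (s≤s (s≤s z≤n)) (+2-mono (suc (suc p)) d lt)

  commute-s₀ : ∀ {j} (sj : GenView j) → 0 ≢ j → ¬ Adj n 0 j → ViewsCommute (view₀ refl) sj
  commute-s₀ (view₀ refl) ne na q = ⊥-elim (ne refl)
  commute-s₀ (viewMid zero refl lt) ne na q = applyAt-same-commute 0 reflect₀ exchange q commute-reflect₀-exchange
  commute-s₀ (viewMid (suc zero) refl lt) ne na q = ⊥-elim (na (inj₁ e02))
  commute-s₀ (viewMid (suc (suc p)) refl lt) ne na q = applyAt-far-commute 0 (suc (suc p)) reflect₀ exchange q (s≤s (s≤s z≤n))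
  commute-s₀ (viewTop refl) ne na q = applyAt-far-commute 0 d reflect₀ reflectₙ q 2≤d

  commute-mid-mid : ∀ p p' (lt : p < suc d) (lt' : p' < suc d) → p < p' → ¬ Adj n (suc p) (suc p') →
    ViewsCommute (viewMid p refl lt) (viewMid p' refl lt')
  commute-mid-mid p p' lt lt' plt na q with ℕP.m≤n⇒m<n∨m≡n plt
  ... | inj₁ far = applyAt-far-commute p p' exchange exchange q far
  ... | inj₂ refl with lt'
  ...   | s≤s lt'' = ⊥-elim (na (inj₁ (edge-mid p lt'')))

  commute-mid-top : ∀ p (lt : p < suc d) → ¬ Adj n (suc p) n → ViewsCommute (viewMid p refl lt) (viewTop refl)
  commute-mid-top p (s≤s le) na q with ℕP.m≤n⇒m<n∨m≡n le
  ... | inj₂ refl = applyAt-same-commute d exchange reflectₙ q commute-exchange-reflectₙ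
  ... | inj₁ lt with ℕP.m≤n⇒m<n∨m≡n lt
  ...   | inj₁ far = applyAt-far-commute p d exchange reflectₙ q far
  ...   | inj₂ refl = ⊥-elim (na (inj₁ en))

  views-commute : ∀ {i j} (si : GenView i) (sj : GenView j) → i ≢ j → ¬ Adj n i j → ViewsCommute si sj
  views-commute (view₀ refl) sj ne na = commute-s₀ sj ne na
  views-commute (viewMid p refl lt) (view₀ refl) ne na =
    ViewsCommute-sym {si = view₀ refl} {sj = viewMid p refl lt} (commute-s₀ (viewMid p refl lt) (λ eq → ne (sym eq)) (λ a → na (adj-sym a)))
  views-commute (viewMid p refl lt) (viewMid p' refl lt') ne na with <-cmp p p'
  ... | tri< p<p' _ _ = commute-mid-mid p p' lt lt' p<p' na
  ... | tri≈ _ refl _ = ⊥-elim (ne refl)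
  ... | tri> _ _ p'<p = ViewsCommute-sym {si = viewMid p' refl lt'} {sj = viewMid p refl lt} (commute-mid-mid p' p lt' lt p'<p (λ a → na (adj-sym a)))
  views-commute (viewMid p refl lt) (viewTop refl) ne na = commute-mid-top p lt na
  views-commute (viewTop refl) (view₀ refl) ne na =
    ViewsCommute-sym {si = view₀ refl} {sj = viewTop refl} (commute-s₀ (viewTop refl) (λ eq → ne (sym eq)) (λ a → na (adj-sym a)))
  views-commute (viewTop refl) (viewMid p refl lt) ne na =
    ViewsCommute-sym {si = viewMid p refl lt} {sj = viewTop refl} (commute-mid-top p lt (λ a → na (adj-sym a)))
  views-commute (viewTop refl) (viewTop refl) ne na = ⊥-elim (ne refl)

  -- Braid relations: adjacent generators act on overlapping pairs by braiding maps.
  braid-by : ∀ {i j} (si : GenView i) (sj : GenView j) q →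
    viewAction si (viewAction sj (viewAction si q)) ≡ viewAction sj (viewAction si (viewAction sj q)) →
    generator n i (generator n j (generator n i q)) ≡ generator n j (generator n i (generator n j q))
  braid-by si sj q eq = trans (generator-view₃ si sj q) (trans eq (sym (generator-view₃ sj si q)))

  ≤-length : ∀ {a} (q : List ℤ) → length q ≡ n → a ≤ n → a ≤ length q
  ≤-length {a} q len le = subst (a ≤_) (sym len) le

  generator-braid : ∀ {i j} → Edge n i j → ∀ q → length q ≡ n →
    generator n i (generator n j (generator n i q)) ≡ generator n j (generator n i (generator n j q))
  generator-braid e02 q len = braid-by (view₀ refl) (viewMid 1 refl (s≤s (s≤s z≤n))) q
    (applyAt-braid 0 reflect₀ exchange q braid-reflect₀-exchange (≤-length q len (s≤s (s≤s (s≤s z≤n)))))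
  generator-braid e12 q len = braid-by (viewMid 0 refl (s≤s z≤n)) (viewMid 1 refl (s≤s (s≤s z≤n))) q
    (applyAt-braid 0 exchange exchange q braid-exchange-exchange (≤-length q len (s≤s (s≤s (s≤s z≤n)))))
  generator-braid (eii {suc i} _ le) q len = braid-by (viewMid i refl (ℕP.<-trans (ℕP.n<1+n i) i+1<n-1)) (viewMid (suc i) refl i+1<n-1) q
    (applyAt-braid i exchange exchange q braid-exchange-exchange (≤-length q len i+3≤n))
    where
    i+3≤n : suc (suc (suc i)) ≤ n
    i+3≤n = subst (_≤ n) (ℕP.+-comm (suc i) 2) le
    i+1<n-1 : suc i < suc d
    i+1<n-1 = ℕP.≤-pred i+3≤n
  generator-braid en q len = braid-by (viewMid (suc e) refl (s≤s (n≤1+n (suc e)))) (viewTop refl) q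
    (applyAt-braid (suc e) exchange reflectₙ q braid-exchange-reflectₙ (≤-length q len ≤-refl))

  act-respects-Rel : ∀ {a a'} → Rel n a a' → ∀ q → length q ≡ n → act n a q ≡ act n a' q
  act-respects-Rel (square {i} le) q len with genView i le
  ... | view₀ refl = applyAt-involution reflect₀ reflect₀-involution 0 q
  ... | viewMid p refl lt = trans (generator-view₂ (viewMid p refl lt) (viewMid p refl lt) q) (applyAt-involution exchange exchange-involution p q)
  ... | viewTop refl = trans (generator-view₂ (viewTop refl) (viewTop refl) q) (applyAt-involution reflectₙ reflectₙ-involution d q)
  act-respects-Rel (comm {i} {j} il jl ne na) q len =
    trans (generator-view₂ si sj q) (trans (views-commute si sj ne na q) (sym (generator-view₂ sj si q)))
    where
    si = genView i il
    sj = genView j jl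
  act-respects-Rel (braid (inj₁ edge)) q len = generator-braid edge q len
  act-respects-Rel (braid (inj₂ edge)) q len = sym (generator-braid edge q len)

  act-respects-≈ : ∀ {v w} → v ≈W[ n ] w → ∀ q → length q ≡ n → act n v q ≡ act n w q
  act-respects-≈ (step {a = a} {b = a'} u v r) q len = begin
      act n (u ++ a ++ v) q     ≡⟨ act-++ n u (a ++ v) q ⟩
      act n u (act n (a ++ v) q) ≡⟨ cong (act n u) (act-++ n a v q) ⟩
      act n u (act n a (act n v q)) ≡⟨ cong (act n u) (act-respects-Rel r (act n v q) (trans (length-act n v q) len)) ⟩
      act n u (act n a' (act n v q)) ≡⟨ cong (act n u) (sym (act-++ n a' v q)) ⟩
      act n u (act n (a' ++ v) q) ≡⟨ sym (act-++ n u (a' ++ v) q) ⟩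
      act n (u ++ a' ++ v) q ∎
    where open ≡-Reasoning
  act-respects-≈ ≈refl q len = refl
  act-respects-≈ (≈sym p) q len = sym (act-respects-≈ p q len)
  act-respects-≈ (≈trans p p') q len = trans (act-respects-≈ p q len) (act-respects-≈ p' q len)

  depth-generator≤ : ∀ i q → length q ≡ n → depth (generator n i q) ≤ suc (depth q)
  depth-generator≤ i q len with ℕP.≤-<-connex i n
  ... | inj₂ lt rewrite generator-outside n i q lt = n≤1+n _
  ... | inj₁ le with genView i le
  ...   | view₀ refl = depth-reflect₀≤ q
  ...   | viewMid p refl lt rewrite generator-mid p q lt = depth-exchange≤ p q
  ...   | viewTop refl rewrite generator-n q = depth-reflectₙ≤ d q len

  depth-act≤ : ∀ w q → length q ≡ n → depth (act n w q) ≤ length w + depth q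
  depth-act≤ [] q len = ≤-refl
  depth-act≤ (i ∷ w) q len = ≤-trans (depth-generator≤ i (act n w q) (trans (length-act n w q) len)) (s≤s (depth-act≤ w q len))

  generator-fixes-origin : ∀ i → InS n i → generator n i (zeros n) ≡ zeros n
  generator-fixes-origin i (1≤i , le) with genView i le
  ... | view₀ refl with 1≤i
  ...   | ()
  generator-fixes-origin i (1≤i , le) | viewMid p refl lt = trans (generator-mid p (zeros n) lt) (exchange-zeros p n)
  generator-fixes-origin i (1≤i , le) | viewTop refl = trans (generator-n (zeros n)) (reflectₙ-zeros d n)

  act-fixes-origin : ∀ u → All (InS n) u → act n u (zeros n) ≡ zeros n
  act-fixes-origin [] [] = refl
  act-fixes-origin (i ∷ u) (pi ∷ pu) rewrite act-fixes-origin u pu = generator-fixes-origin i pi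

  depth-lower-bound : ∀ v w → v ≈W[ n ] w → depth (act n w (zeros n)) ≤ length v
  depth-lower-bound v w eq = subst (_≤ length v) (cong depth (act-respects-≈ eq (zeros n) (length-zeros n)))
     (≤-trans (depth-act≤ v (zeros n) (length-zeros n)) (≤-reflexive (trans (cong (λ t → length v + t) (depth-zeros n)) (ℕP.+-identityʳ _))))

  full-depth-minimal : ∀ w m → depth (act n w (zeros n)) ≡ m → length w ≡ m → InWS n w × HasLength n w m
  full-depth-minimal w m full length-w = minimal , (w , ≈refl , length-w) , shortest
    where
    shortest : ∀ v → v ≈W[ n ] w → m ≤ length v
    shortest v eq = subst (_≤ length v) full (depth-lower-bound v w eq)
    minimal : InWS n w
    minimal u u∈S v eq = w , ≈refl , ≤-trans (≤-reflexive length-w) (subst (_≤ length v) depth-wu (depth-lower-bound v (w ++ u) eq))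
      where
      depth-wu : depth (act n (w ++ u) (zeros n)) ≡ m
      depth-wu = trans (cong depth (trans (act-++ n w u (zeros n)) (cong (act n w) (act-fixes-origin u u∈S)))) full

  infix 4 _∼_
  _∼_ : Word → Word → Set
  x ∼ y = x ≈W[ n ] y

  ∼-cong : ∀ {x y} (u v : Word) → x ∼ y → (u ++ x ++ v) ∼ (u ++ y ++ v)
  ∼-cong u v (step {a = a} {b = a'} u' v' r) = subst₂ _∼_ (reassoc a) (reassoc a') (step (u ++ u') (v' ++ v) r)
    where
    reassoc : ∀ a → (u ++ u') ++ a ++ v' ++ v ≡ u ++ (u' ++ a ++ v') ++ v
    reassoc a = trans (++-assoc u u' _) (cong (u ++_) (sym (trans (++-assoc u' (a ++ v') v) (cong (u' ++_) (++-assoc a v' v)))))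
  ∼-cong u v ≈refl = ≈refl
  ∼-cong u v (≈sym p) = ≈sym (∼-cong u v p)
  ∼-cong u v (≈trans p q) = ≈trans (∼-cong u v p) (∼-cong u v q)

  ∼-congʳ : ∀ {x y} (v : Word) → x ∼ y → (x ++ v) ∼ (y ++ v)
  ∼-congʳ v p = ∼-cong [] v p

  ∼-congˡ : ∀ {x y} (u : Word) → x ∼ y → (u ++ x) ∼ (u ++ y)
  ∼-congˡ {x} {y} u p = subst₂ _∼_ (cong (u ++_) (++-identityʳ x)) (cong (u ++_) (++-identityʳ y)) (∼-cong u [] p)

  infixr 5 _⟫_
  _⟫_ : ∀ {x y z} → x ∼ y → y ∼ z → x ∼ z
  _⟫_ = ≈trans

  ≡⇒∼ : ∀ {x y} → x ≡ y → x ∼ y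
  ≡⇒∼ refl = ≈refl

  commute-rel : ∀ {i j} → i ≤ n → j ≤ n → i ≢ j → ¬ Adj n i j → (i ∷ j ∷ []) ∼ (j ∷ i ∷ [])
  commute-rel il jl ne na = step [] [] (comm il jl ne na)

  braid-rel : ∀ {i j} → Adj n i j → (i ∷ j ∷ i ∷ []) ∼ (j ∷ i ∷ j ∷ [])
  braid-rel a = step [] [] (braid a)

  square-rel : ∀ {i} → i ≤ n → (i ∷ i ∷ []) ∼ []
  square-rel il = step [] [] (square il)

  CommutesWith : ℕ → ℕ → Set
  CommutesWith x w = (w ∷ x ∷ []) ∼ (x ∷ w ∷ [])

  move-past : ∀ W x → All (CommutesWith x) W → (W ++ x ∷ []) ∼ (x ∷ W)
  move-past [] x [] = ≈refl
  move-past (w ∷ W) x (p ∷ ps) = ∼-congˡ (w ∷ []) (move-past W x ps) ⟫ ∼-congʳ W p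

  ¬+2≤suc : ∀ x → ¬ (x + 2 ≤ suc x)
  ¬+2≤suc x le rewrite +-comm x 2 = ℕP.<-irrefl refl le

  ¬+2≤< : ∀ x y → ¬ (x + 2 ≤ y × y < x)
  ¬+2≤< x y (le , lt) = ℕP.<-irrefl refl (≤-trans (≤-trans (s≤s (ℕP.m≤m+n x 2)) (s≤s le)) lt)

  -- Letters 1 ≤ x < y at distance at least two commute, except the pair (n-2, n).
  not-adjacent : ∀ x y → 1 ≤ x → x + 2 ≤ y → y ≤ n → (y ≡ n → x + 3 ≤ n) → ¬ Adj n x y
  not-adjacent x y 1x gap yn hn (inj₁ edge) with edge-cases edge
  ... | inj₁ (refl , _) with 1x
  ...   | ()
  not-adjacent x y 1x gap yn hn (inj₁ edge) | inj₂ (inj₁ (refl , refl)) with gap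
  ...   | s≤s (s≤s ())
  not-adjacent x y 1x gap yn hn (inj₁ edge) | inj₂ (inj₂ (inj₁ (_ , _ , refl))) = ¬+2≤suc x gap
  not-adjacent x y 1x gap yn hn (inj₁ edge) | inj₂ (inj₂ (inj₂ (refl , refl))) = ¬+2≤suc (suc d) (subst (_≤ n) (+-suc d 2) (hn refl))
  not-adjacent x y 1x gap yn hn (inj₂ edge) with edge-cases edge
  ... | inj₁ (refl , refl) with gap
  ...   | ()
  not-adjacent x y 1x gap yn hn (inj₂ edge) | inj₂ (inj₁ (refl , refl)) with gap
  ...   | s≤s ()
  not-adjacent x y 1x gap yn hn (inj₂ edge) | inj₂ (inj₂ (inj₁ (_ , _ , refl))) = ¬+2≤< x y (gap , ℕP.n<1+n y)
  not-adjacent x y 1x gap yn hn (inj₂ edge) | inj₂ (inj₂ (inj₂ (refl , refl))) = ¬+2≤< x y (gap , s≤s (n≤1+n d))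

  commute-distant : ∀ x y → 1 ≤ x → x + 2 ≤ y → y ≤ n → (y ≡ n → x + 3 ≤ n) → (x ∷ y ∷ []) ∼ (y ∷ x ∷ [])
  commute-distant x y 1x gap yn hn = commute-rel (≤-trans (ℕP.m≤m+n x 2) (≤-trans gap yn)) yn x≢y (not-adjacent x y 1x gap yn hn)
    where
    x≢y : x ≢ y
    x≢y refl = ¬+2≤suc x (≤-trans gap (n≤1+n x))

  ¬adj-n-1-n : ¬ Adj n (suc d) n
  ¬adj-n-1-n (inj₁ edge) with edge-cases edge
  ... | inj₂ (inj₂ (inj₁ (_ , le , _))) = ¬+2≤suc (suc d) le
  ... | inj₂ (inj₂ (inj₂ (() , _)))
  ¬adj-n-1-n (inj₂ edge) with edge-cases edge
  ... | inj₂ (inj₂ (inj₁ (_ , _ , ())))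

  commute-n-1-n : (suc d ∷ n ∷ []) ∼ (n ∷ suc d ∷ [])
  commute-n-1-n = commute-rel (n≤1+n (suc d)) ≤-refl (λ ()) ¬adj-n-1-n

  ¬adj-0-1 : ¬ Adj n 0 1
  ¬adj-0-1 (inj₁ edge) with edge-cases edge
  ... | inj₂ (inj₂ (inj₂ (() , _)))
  ¬adj-0-1 (inj₂ edge) with edge-cases edge
  ... | inj₂ (inj₂ (inj₂ (_ , ())))

  commute-0-1 : (0 ∷ 1 ∷ []) ∼ (1 ∷ 0 ∷ [])
  commute-0-1 = commute-rel z≤n (s≤s z≤n) (λ ()) ¬adj-0-1

  -- A chain of type A_top inside W̃: letters c 1, …, c top in which neighbours
  -- satisfy the braid relation and letters at distance ≥ 2 commute.
  record Chain : Set where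
    field
      letter : ℕ → ℕ
      top : ℕ
      braids : ∀ i → 1 ≤ i → suc i ≤ top →
        (letter i ∷ letter (suc i) ∷ letter i ∷ []) ∼ (letter (suc i) ∷ letter i ∷ letter (suc i) ∷ [])
      commutes : ∀ i j → 1 ≤ i → i + 2 ≤ j → j ≤ top → (letter i ∷ letter j ∷ []) ∼ (letter j ∷ letter i ∷ [])
      valid : ∀ i → 1 ≤ i → i ≤ top → letter i ≤ n

  module ChainMoves (ch : Chain) where
    open Chain ch

    chain : ℕ → Word
    chain = downVia letter

    all-chain : ∀ {P : ℕ → Set} k → (∀ i → 1 ≤ i → i ≤ k → P (letter i)) → All P (chain k)
    all-chain zero f = []
    all-chain (suc k) f = f (suc k) (s≤s z≤n) ≤-refl ∷ all-chain k (λ i 1i ik → f i 1i (≤-trans ik (n≤1+n k)))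

    absorb-letter : ∀ m i → 2 ≤ i → i ≤ m → m ≤ top → (chain m ++ letter i ∷ []) ∼ (letter (pred i) ∷ chain m)
    absorb-letter (suc m') (suc i') 2i im mL with ℕP.m≤n⇒m<n∨m≡n im
    ... | inj₁ (s≤s im') = ∼-congˡ (letter (suc m') ∷ []) (absorb-letter m' (suc i') 2i im' (≤-trans (n≤1+n m') mL))
                          ⟫ ∼-congʳ (chain m') (≈sym (commutes i' (suc m') (ℕP.≤-pred 2i) gap mL))
      where
      gap : i' + 2 ≤ suc m'
      gap rewrite +-comm i' 2 = s≤s im'
    absorb-letter (suc zero) (suc zero) (s≤s ()) im mL | inj₂ refl
    absorb-letter (suc (suc m'')) (suc (suc m'')) 2i im mL | inj₂ refl =
        ∼-congˡ (letter (suc (suc m'')) ∷ letter (suc m'') ∷ [])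
          (move-past (chain m'') (letter (suc (suc m''))) (all-chain m'' (λ i 1i le → commutes i (suc (suc m'')) 1i (gap i le) mL)))
      ⟫ ∼-congʳ (chain m'') (≈sym (braids (suc m'') (s≤s z≤n) mL))
      where
      gap : ∀ i → i ≤ m'' → i + 2 ≤ suc (suc m'')
      gap i le rewrite +-comm i 2 = s≤s (s≤s le)

    absorb-segment : ∀ r m → suc r ≤ m → m ≤ top → (chain m ++ downVia (λ i → letter (suc i)) r) ∼ (chain r ++ chain m)
    absorb-segment zero m rm mL = ≡⇒∼ (++-identityʳ _)
    absorb-segment (suc r) m rm mL =
        ≡⇒∼ (sym (++-assoc (chain m) (letter (suc (suc r)) ∷ []) _))
      ⟫ ∼-congʳ (downVia (λ i → letter (suc i)) r) (absorb-letter m (suc (suc r)) (s≤s (s≤s z≤n)) rm mL)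
      ⟫ ∼-congˡ (letter (suc r) ∷ []) (absorb-segment r m (≤-trans (n≤1+n _) rm) mL)

    cancel-pair : ∀ k m → 1 ≤ k → k ≤ m → m ≤ top → Σ Word λ V → ((chain m ++ chain k) ∼ V) × (length V + 2 ≡ m + k)
    cancel-pair (suc r) (suc m') _ km mL = V , derivation , length-V
      where
      shifted = downVia (λ i → letter (suc i))
      V = chain r ++ shifted m'
      split-right : chain (suc m') ++ chain (suc r) ≡ (chain (suc m') ++ shifted r) ++ letter 1 ∷ []
      split-right = trans (cong (chain (suc m') ++_) (downVia-split letter r)) (sym (++-assoc (chain (suc m')) _ (letter 1 ∷ [])))
      split-left : (chain r ++ chain (suc m')) ++ letter 1 ∷ [] ≡ V ++ (letter 1 ∷ letter 1 ∷ [])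
      split-left = trans (cong (λ t → (chain r ++ t) ++ letter 1 ∷ []) (downVia-split letter m'))
             (trans (++-assoc (chain r) _ (letter 1 ∷ []))
             (trans (cong (chain r ++_) (++-assoc (shifted m') (letter 1 ∷ []) (letter 1 ∷ []))) (sym (++-assoc (chain r) (shifted m') _))))
      derivation : (chain (suc m') ++ chain (suc r)) ∼ V
      derivation = ≡⇒∼ split-right ⟫ ∼-congʳ (letter 1 ∷ []) (absorb-segment r (suc m') km mL) ⟫ ≡⇒∼ split-left
            ⟫ ∼-congˡ V (square-rel (valid 1 (s≤s z≤n) (≤-trans (s≤s z≤n) mL))) ⟫ ≡⇒∼ (++-identityʳ V)
      length-V : length V + 2 ≡ suc m' + suc r
      length-V rewrite length-++ (chain r) {shifted m'} | length-downVia letter r | length-downVia (λ i → letter (suc i)) m' = arith r m'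
        where
        arith : ∀ r m' → r + m' + 2 ≡ suc m' + suc r
        arith = NS.solve-∀

  adjacent-succ : ∀ i → 1 ≤ i → i ≤ d → Adj n i (suc i)
  adjacent-succ (suc zero) _ _ = inj₁ e12
  adjacent-succ (suc (suc i)) _ le = inj₁ (eii (s≤s (s≤s z≤n)) (+2-mono (suc (suc i)) d le))

  chainA : Chain
  chainA = record
    { letter = λ i → i
    ; top = suc d
    ; braids = λ i 1i le → braid-rel (adjacent-succ i 1i (ℕP.≤-pred le))
    ; commutes = λ i j 1i gap jL → commute-distant i j 1i gap (≤-trans jL (n≤1+n _)) (λ { refl → ⊥-elim (ℕP.<-irrefl refl jL) })
    ; valid = λ i _ le → ≤-trans le (n≤1+n _)
    }

  forkLetter : ℕ → ℕ
  forkLetter i with i ≟ suc d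
  ... | yes _ = n
  ... | no _ = i

  forkLetter-low : ∀ i → i ≤ d → forkLetter i ≡ i
  forkLetter-low i le with i ≟ suc d
  ... | yes refl = ⊥-elim (ℕP.<-irrefl refl le)
  ... | no _ = refl

  forkLetter-top : forkLetter (suc d) ≡ n
  forkLetter-top with suc d ≟ suc d
  ... | yes _ = refl
  ... | no ne = ⊥-elim (ne refl)

  fork-braids : ∀ i → 1 ≤ i → suc i ≤ suc d → (forkLetter i ∷ forkLetter (suc i) ∷ forkLetter i ∷ []) ∼ (forkLetter (suc i) ∷ forkLetter i ∷ forkLetter (suc i) ∷ [])
  fork-braids i 1i (s≤s le) with ℕP.m≤n⇒m<n∨m≡n le
  ... | inj₁ lt rewrite forkLetter-low i le | forkLetter-low (suc i) lt = braid-rel (adjacent-succ i 1i le)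
  ... | inj₂ refl rewrite forkLetter-low d ≤-refl | forkLetter-top = braid-rel (inj₁ en)

  +2≤suc⇒< : ∀ i → i + 2 ≤ suc d → suc i ≤ d
  +2≤suc⇒< i g rewrite +-comm i 2 = ℕP.≤-pred g

  fork-commutes : ∀ i j → 1 ≤ i → i + 2 ≤ j → j ≤ suc d → (forkLetter i ∷ forkLetter j ∷ []) ∼ (forkLetter j ∷ forkLetter i ∷ [])
  fork-commutes i j 1i gap jL with ℕP.m≤n⇒m<n∨m≡n jL
  ... | inj₁ (s≤s lt) rewrite forkLetter-low j lt | forkLetter-low i (≤-trans (ℕP.m≤m+n i 2) (≤-trans gap lt)) =
        commute-distant i j 1i gap (≤-trans lt (≤-trans (n≤1+n d) (n≤1+n _))) (λ { refl → ⊥-elim (ℕP.<-irrefl refl (≤-trans (s≤s lt) (n≤1+n _))) })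
  ... | inj₂ refl rewrite forkLetter-top | forkLetter-low i (≤-trans (n≤1+n i) (+2≤suc⇒< i gap)) =
        commute-distant i n 1i (≤-trans gap (n≤1+n _)) ≤-refl (λ _ → subst (_≤ n) (sym (+-suc i 2)) (s≤s gap))

  chainFork : Chain
  chainFork = record
    { letter = forkLetter
    ; top = suc d
    ; braids = fork-braids
    ; commutes = fork-commutes
    ; valid = λ i _ le → fork-valid i le
    }
    where
    fork-valid : ∀ i → i ≤ suc d → forkLetter i ≤ n
    fork-valid i le with i ≟ suc d
    ... | yes _ = ≤-refl
    ... | no _ = ≤-trans le (n≤1+n _)

  downVia-fork : ∀ k → k ≤ d → downVia forkLetter k ≡ down k
  downVia-fork zero _ = refl
  downVia-fork (suc k) le rewrite forkLetter-low (suc k) le = cong (suc k ∷_) (downVia-fork k (≤-trans (n≤1+n k) le))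

  downVia-fork-top : downVia forkLetter (suc d) ≡ n ∷ down d
  downVia-fork-top rewrite forkLetter-top = cong (n ∷_) (downVia-fork d ≤-refl)

  <⇒+2≤suc : ∀ w → suc w ≤ d → w + 2 ≤ suc d
  <⇒+2≤suc w wd = subst (_≤ suc d) (sym (+-comm w 2)) (s≤s wd)

  commute-with-n : ∀ w → 1 ≤ w → suc w ≤ d → (w ∷ n ∷ []) ∼ (n ∷ w ∷ [])
  commute-with-n w 1w wd = commute-distant w n 1w (≤-trans (<⇒+2≤suc w wd) (n≤1+n _)) ≤-refl
                   (λ _ → subst (_≤ n) (sym (+-suc w 2)) (s≤s (<⇒+2≤suc w wd)))

  commute-with-n-1 : ∀ w → 1 ≤ w → suc w ≤ d → (w ∷ suc d ∷ []) ∼ (suc d ∷ w ∷ [])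
  commute-with-n-1 w 1w wd = commute-distant w (suc d) 1w (<⇒+2≤suc w wd) (n≤1+n _)
                   (λ { () })

  n≰d : ¬ (n ≤ d)
  n≰d h = ℕP.<-irrefl refl (≤-trans (n≤1+n (suc d)) h)

  up-absorb-first : ∀ t a → 1 ≤ a → a + 2 ≤ a + suc t → a + suc t ≤ suc d → (up a (suc t) ++ a ∷ []) ∼ (suc a ∷ up a (suc t))
  up-absorb-first zero a 1a gap top = ⊥-elim (ℕP.<-irrefl refl (ℕP.+-cancelˡ-≤ a 2 1 gap))
  up-absorb-first (suc t) a 1a gap top =
      ∼-congˡ (a ∷ suc a ∷ []) (move-past (up (suc (suc a)) t) a (all-up (suc (suc a)) t (λ w aw wt → ≈sym (commute-distant a w 1a (a2w w aw) (wn w wt) (λ e → ⊥-elim (n≰d (subst (_≤ d) e (wd w wt))))))))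
    ⟫ ∼-congʳ (up (suc (suc a)) t) (braid-rel (adjacent-succ a 1a (≤-trans (n≤1+n a) sad)))
    where
    top' : suc (suc a) + t ≤ suc d
    top' = subst (_≤ suc d) (trans (+-suc a (suc t)) (cong suc (+-suc a t))) top
    a2w : ∀ w → suc (suc a) ≤ w → a + 2 ≤ w
    a2w w aw = subst (_≤ w) (+-comm 2 a) aw
    wd : ∀ w → w < suc (suc a) + t → w ≤ d
    wd w wt = ℕP.≤-pred (≤-trans wt top')
    wn : ∀ w → w < suc (suc a) + t → w ≤ n
    wn w wt = ≤-trans (wd w wt) (≤-trans (n≤1+n d) (n≤1+n _))
    sad : suc a ≤ d
    sad = ℕP.≤-pred (≤-trans (s≤s (s≤s (ℕP.m≤m+n a t))) top')

  up-absorb : ∀ t a i → 1 ≤ a → a ≤ i → i + 2 ≤ a + t → a + t ≤ suc d → (up a t ++ i ∷ []) ∼ (suc i ∷ up a t)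
  up-absorb zero a i 1a ai gap top = ⊥-elim (ℕP.<-irrefl refl (≤-trans (≤-trans (s≤s (ℕP.m≤m+n i 1)) (subst (_≤ a + 0) (+-suc i 1) gap)) (≤-trans (≤-reflexive (ℕP.+-identityʳ a)) ai)))
  up-absorb (suc t) a i 1a ai gap top with ℕP.m≤n⇒m<n∨m≡n ai
  ... | inj₁ lt = ∼-congˡ (a ∷ []) (up-absorb t (suc a) i (s≤s z≤n) lt (subst (i + 2 ≤_) (+-suc a t) gap) (subst (_≤ suc d) (+-suc a t) top))
                  ⟫ ∼-congʳ (up (suc a) t) (commute-distant a (suc i) 1a (subst (_≤ suc i) (sym (+-comm a 2)) (s≤s lt)) si≤n
                       (λ e → ⊥-elim (n≰d (subst (_≤ d) e si≤d))))
    where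
    si≤d : suc i ≤ d
    si≤d = ℕP.≤-pred (subst (_≤ suc d) (+-comm i 2) (≤-trans gap top))
    si≤n : suc i ≤ n
    si≤n = ≤-trans si≤d (≤-trans (n≤1+n d) (n≤1+n _))
  ... | inj₂ refl = up-absorb-first t a 1a gap top

  -- The long 1-segment σ₁(n + t) = s_{r+1} ⋯ s_{n-2} · s_{n-1} sₙ · s_{n-2} ⋯ s₁ (r + t = n - 2).
  longSegment : ℕ → ℕ → Word
  longSegment r t = up (suc r) t ++ suc d ∷ n ∷ down d

  down-absorb : ∀ i → 2 ≤ i → i ≤ d → (down d ++ i ∷ []) ∼ (pred i ∷ down d)
  down-absorb i 2i id = subst₂ _∼_ (cong (_++ i ∷ []) (downVia-id d)) (cong (pred i ∷_) (downVia-id d))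
                   (ChainMoves.absorb-letter chainA d i 2i id (n≤1+n d))

  longSegment-commute : ∀ r t i → r + t ≡ d → suc r < i → i ≤ d → (longSegment r t ++ i ∷ []) ∼ (i ∷ longSegment r t)
  longSegment-commute r t (suc i') rt ri id =
      ≡⇒∼ (++-assoc U (suc d ∷ n ∷ down d) (suc i' ∷ []))
    ⟫ ∼-congˡ U (∼-congˡ (suc d ∷ n ∷ []) (down-absorb (suc i') (≤-trans (s≤s (s≤s z≤n)) ri) id))
    ⟫ ∼-congˡ U (∼-congʳ (down d) (move-past (suc d ∷ n ∷ []) i' (≈sym (commute-with-n-1 i' 1i' id) ∷ ≈sym (commute-with-n i' 1i' id) ∷ [])))
    ⟫ ≡⇒∼ (sym (++-assoc U (i' ∷ []) (suc d ∷ n ∷ down d)))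
    ⟫ ∼-congʳ (suc d ∷ n ∷ down d) (up-absorb t (suc r) i' (s≤s z≤n) (ℕP.≤-pred ri) (subst (i' + 2 ≤_) (cong suc (sym rt)) (<⇒+2≤suc i' id)) (≤-reflexive (cong suc rt)))
    where
    U = up (suc r) t
    1i' : 1 ≤ i'
    1i' = ℕP.≤-pred (≤-trans (s≤s (s≤s z≤n)) ri)

  longSegment-absorb-n : ∀ r t → r + suc t ≡ d → (longSegment r (suc t) ++ n ∷ []) ∼ (suc d ∷ longSegment r (suc t))
  longSegment-absorb-n r t rt =
      ≡⇒∼ (trans (cong (_++ n ∷ []) regroup) (++-assoc U' (d ∷ suc d ∷ n ∷ d ∷ down (suc e)) (n ∷ [])))
    ⟫ ∼-congˡ U' (∼-congˡ (d ∷ suc d ∷ n ∷ d ∷ []) (move-past (down (suc e)) n (all-down (suc e) (λ w 1w we → commute-with-n w 1w (s≤s we)))))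
    ⟫ ∼-congˡ U' (∼-congˡ (d ∷ suc d ∷ []) (∼-congʳ (down (suc e)) (braid-rel (inj₂ en))))
    ⟫ ∼-congˡ U' (∼-congʳ (n ∷ d ∷ down (suc e)) (braid-rel (adjacent-succ d (s≤s z≤n) ≤-refl)))
    ⟫ ≡⇒∼ (sym (++-assoc U' (suc d ∷ []) _))
    ⟫ ∼-congʳ (d ∷ suc d ∷ n ∷ d ∷ down (suc e)) (move-past U' (suc d) (all-up (suc r) t (λ w rw wt → commute-with-n-1 w (≤-trans (s≤s z≤n) rw) (subst (suc w ≤_) rt' wt))))
    ⟫ ≡⇒∼ (cong (suc d ∷_) (sym regroup))
    where
    U' = up (suc r) t
    rt' : suc r + t ≡ d
    rt' = trans (sym (+-suc r t)) rt
    regroup : longSegment r (suc t) ≡ U' ++ d ∷ suc d ∷ n ∷ d ∷ down (suc e)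
    regroup = trans (cong (_++ suc d ∷ n ∷ down d) (up-snoc (suc r) t))
          (trans (++-assoc U' ((suc r + t) ∷ []) _) (cong (λ x → U' ++ x ∷ suc d ∷ n ∷ down d) rt'))

  longSegment-swap-fork : ∀ r t → longSegment r t ∼ (up (suc r) t ++ n ∷ suc d ∷ down d)
  longSegment-swap-fork r t = ∼-congˡ (up (suc r) t) (∼-congʳ (down d) commute-n-1-n)

  σ₁-short : ∀ j y → j ≤ d → σ₁ n j y ≡ down j
  σ₁-short j y le with j ≤? n ∸ 2
  ... | yes _ = refl
  ... | no ¬p = ⊥-elim (¬p le)

  σ₁-middle : ∀ y → σ₁ n (suc d) y ≡ col n y
  σ₁-middle y with suc d ≤? n ∸ 2
  ... | yes p = ⊥-elim (ℕP.<-irrefl refl p)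
  ... | no _ with suc d ≟ n ∸ 1
  ...   | yes _ = refl
  ...   | no ne = ⊥-elim (ne refl)

  long-start : ∀ r t → r + t ≡ d → 2 * n ∸ (n + t) ∸ 1 ≡ suc r
  long-start r t rt = begin
      2 * n ∸ (n + t) ∸ 1 ≡⟨ cong (_∸ 1) (ℕP.[m+n]∸[m+o]≡n∸o n (n + 0) t) ⟩
      (n + 0) ∸ t ∸ 1 ≡⟨ cong (λ x → x ∸ t ∸ 1) (ℕP.+-identityʳ n) ⟩
      n ∸ t ∸ 1 ≡⟨ cong (λ x → suc (suc x) ∸ t ∸ 1) (sym rt) ⟩
      suc (suc (r + t)) ∸ t ∸ 1 ≡⟨ cong (_∸ 1) (ℕP.m+n∸n≡m (suc (suc r)) t) ⟩
      suc r ∎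
    where open ≡-Reasoning

  σ₁-long : ∀ r t y → r + t ≡ d → σ₁ n (n + t) y ≡ longSegment r t
  σ₁-long r t y rt with n + t ≤? n ∸ 2
  ... | yes p = ⊥-elim (n≰d (≤-trans (ℕP.m≤m+n n t) p))
  ... | no _ with n + t ≟ n ∸ 1
  ...   | yes p = ⊥-elim (ℕP.<-irrefl refl (≤-trans (ℕP.m≤m+n n t) (≤-reflexive p)))
  ...   | no _ = cong₂ (λ a b → up a b ++ suc d ∷ n ∷ down d) (long-start r t rt) (ℕP.m+n∸m≡n n t)

  τ-fixed : ∀ i → 2 ≤ i → i ≤ d → τ n i ≡ i
  τ-fixed (suc zero) (s≤s ()) _
  τ-fixed (suc (suc i)) _ le with suc (suc i) ≟ n ∸ 1
  ... | yes p = ⊥-elim (ℕP.<-irrefl refl (≤-trans (≤-reflexive (cong suc (sym p))) (s≤s le)))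
  ... | no _ with suc (suc i) ≟ n
  ...   | yes p = ⊥-elim (n≰d (subst (_≤ d) p le))
  ...   | no _ = refl

  τ-n-1 : τ n (suc d) ≡ n
  τ-n-1 with suc d ≟ n ∸ 1
  ... | yes _ = refl
  ... | no ne = ⊥-elim (ne refl)

  τ-n : τ n n ≡ suc d
  τ-n with n ≟ n ∸ 1
  ... | yes p = ⊥-elim (ℕP.<-irrefl refl (≤-reflexive p))
  ... | no _ with n ≟ n
  ...   | yes _ = refl
  ...   | no ne = ⊥-elim (ne refl)

  τ-down : ∀ t → suc t ≤ d → map (τ n) (down (suc t)) ≡ down₂ t ++ 0 ∷ []
  τ-down zero _ = refl
  τ-down (suc t) le = cong₂ _∷_ (τ-fixed (suc (suc t)) (s≤s (s≤s z≤n)) le) (τ-down t (≤-trans (n≤1+n _) le))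

  τ-up : ∀ a t → 2 ≤ a → a + t ≤ suc d → map (τ n) (up a t) ≡ up a t
  τ-up a zero _ _ = refl
  τ-up a (suc t) 2a le = cong₂ _∷_ (τ-fixed a 2a (ℕP.≤-pred (≤-trans (s≤s (ℕP.m≤m+n a t)) (subst (_≤ suc d) (+-suc a t) le))))
                            (τ-up (suc a) t (≤-trans 2a (n≤1+n a)) (subst (_≤ suc d) (+-suc a t) le))

  -- The 0-segments in the same ranges; σ₀-longest is the case k = 2n-2, whose
  -- ascending part starts with s₀.
  σ₀-short : ∀ r z → suc r ≤ d → σ₀ n (suc r) z ≡ down₂ r ++ 0 ∷ []
  σ₀-short r z le = trans (cong (map (τ n)) (σ₁-short (suc r) z le)) (τ-down r le)

  σ₀-middle-b : σ₀ n (suc d) cB ≡ n ∷ down₂ (suc e) ++ 0 ∷ []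
  σ₀-middle-b = trans (cong (map (τ n)) (σ₁-middle cB)) (cong₂ _∷_ τ-n-1 (τ-down (suc e) ≤-refl))

  σ₀-middle-c : σ₀ n (suc d) cC ≡ suc d ∷ down₂ (suc e) ++ 0 ∷ []
  σ₀-middle-c = trans (cong (map (τ n)) (σ₁-middle cC)) (cong₂ _∷_ τ-n (τ-down (suc e) ≤-refl))

  τ-fork-tail : map (τ n) (suc d ∷ n ∷ down d) ≡ n ∷ suc d ∷ down₂ (suc e) ++ 0 ∷ []
  τ-fork-tail = cong₂ _∷_ τ-n-1 (cong₂ _∷_ τ-n (τ-down (suc e) ≤-refl))

  σ₀-long : ∀ r t z → r + t ≡ d → 1 ≤ r → σ₀ n (n + t) z ≡ up (suc r) t ++ n ∷ suc d ∷ down₂ (suc e) ++ 0 ∷ []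
  σ₀-long r t z rt 1r = trans (cong (map (τ n)) (σ₁-long r t z rt))
     (trans (map-++ (τ n) (up (suc r) t) (suc d ∷ n ∷ down d))
       (cong₂ _++_ (τ-up (suc r) t (s≤s 1r) (≤-reflexive (cong suc rt))) τ-fork-tail))

  σ₀-longest : ∀ z → σ₀ n (n + d) z ≡ 0 ∷ up 2 (suc e) ++ n ∷ suc d ∷ down₂ (suc e) ++ 0 ∷ []
  σ₀-longest z = trans (cong (map (τ n)) (σ₁-long 0 d z refl))
     (trans (map-++ (τ n) (up 1 d) (suc d ∷ n ∷ down d))
       (cong₂ _++_ (cong (0 ∷_) (τ-up 2 (suc e) (s≤s (s≤s z≤n)) (≤-reflexive refl))) τ-fork-tail))

  data LengthRange (j : ℕ) : Set where
    short : ∀ r → j ≡ suc r → suc r ≤ d → LengthRange j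
    middle : j ≡ suc d → LengthRange j
    long : ∀ r t → j ≡ n + t → r + t ≡ d → LengthRange j

  2n-2≡n+d : 2 * n ∸ 2 ≡ n + d
  2n-2≡n+d = trans (cong (λ x → d + x) (ℕP.+-identityʳ n)) (+-comm d n)

  lengthRange : ∀ j → 1 ≤ j → j ≤ 2 * n ∸ 2 → LengthRange j
  lengthRange (suc r) _ le with suc r ≤? d
  ... | yes p = short r refl p
  ... | no np with suc r ≟ suc d
  ...   | yes p = middle p
  ...   | no ne = long (d ∸ t) t jt (ℕP.m∸n+n≡m tle)
    where
    gt : n ≤ suc r
    gt = ℕP.≰⇒> (λ h → [ (λ lt → np (ℕP.≤-pred lt)) , ne ]′ (ℕP.m≤n⇒m<n∨m≡n h))
    t = suc r ∸ n
    jt : suc r ≡ n + t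
    jt = sym (ℕP.m+[n∸m]≡n gt)
    tle : t ≤ d
    tle = ℕP.+-cancelˡ-≤ n t d (subst (_≤ n + d) jt (subst (suc r ≤_) 2n-2≡n+d le))

  Shortening : ℕ → ℕ → Color → Color → Set
  Shortening j k y z = Σ Word (λ V → (((σ₁ n j y ++ σ₀ n k z) ++ 1 ∷ []) ∼ V) × (suc (length V) ≡ j + k))

  -- A shortening contradicts w ∈ W̃^S with ℓ(w) = j + k, since s₁ ∈ W_S.
  shortening-refutes : ∀ j k y z → Shortening j k y z → InWS n (σ₁ n j y ++ σ₀ n k z) → HasLength n (σ₁ n j y ++ σ₀ n k z) (j + k) → ⊥
  shortening-refutes j k y z (V , der , len) ws hl with ws (1 ∷ []) ((s≤s z≤n , s≤s z≤n) ∷ []) V (≈sym der)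
  ... | w' , w'≈ , le = ℕP.<-irrefl refl (≤-trans (≤-trans (s≤s (proj₂ hl w' w'≈)) (s≤s le)) (≤-reflexive len))

  -- Every w here ends with s₀, which commutes with s₁; so it suffices that
  -- w = X P s₀ where X P s₁ has an expression of length j + k - 2.
  shortening-by-cancellation : ∀ j k y z X P V' → σ₁ n j y ++ σ₀ n k z ≡ X ++ P ++ 0 ∷ [] → (X ++ P ++ 1 ∷ []) ∼ V' → length V' + 2 ≡ j + k → Shortening j k y z
  shortening-by-cancellation j k y z X P V' eq der len = (V' ++ 0 ∷ []) , d1 , l1
    where
    d1 : ((σ₁ n j y ++ σ₀ n k z) ++ 1 ∷ []) ∼ (V' ++ 0 ∷ [])
    d1 = ≡⇒∼ (trans (cong (_++ 1 ∷ []) eq) (trans (++-assoc X (P ++ 0 ∷ []) (1 ∷ [])) (cong (X ++_) (trans (++-assoc P (0 ∷ []) (1 ∷ [])) refl))))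
       ⟫ ≡⇒∼ (sym (++-assoc X P (0 ∷ 1 ∷ [])))
       ⟫ ∼-congˡ (X ++ P) commute-0-1
       ⟫ ≡⇒∼ (trans (++-assoc X P (1 ∷ 0 ∷ [])) (cong (X ++_) (sym (++-assoc P (1 ∷ []) (0 ∷ [])))))
       ⟫ ≡⇒∼ (sym (++-assoc X (P ++ 1 ∷ []) (0 ∷ [])))
       ⟫ ∼-congʳ (0 ∷ []) der
    l1 : suc (length (V' ++ 0 ∷ [])) ≡ j + k
    l1 = trans (cong suc (trans (length-++ V') (+-comm (length V') 1))) (trans (+-comm 2 (length V')) len)

  cancel-down : ∀ k m → 1 ≤ k → k ≤ m → m ≤ suc d → Σ Word λ V → ((down m ++ down k) ∼ V) × (length V + 2 ≡ m + k)
  cancel-down k m 1k km mL with ChainMoves.cancel-pair chainA k m 1k km mL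
  ... | V , der , len = V , subst (_∼ V) (cong₂ _++_ (downVia-id m) (downVia-id k)) der , len

  cancel-fork : ∀ k → 1 ≤ k → k ≤ suc d → Σ Word λ V → ((downVia forkLetter (suc d) ++ downVia forkLetter k) ∼ V) × (length V + 2 ≡ suc d + k)
  cancel-fork k 1k kL = ChainMoves.cancel-pair chainFork k (suc d) 1k kL ≤-refl

  -- The failing cases with j ≤ n-1 (then k ≤ j, and colours differ if j = k = n-1):
  -- X P s₁ is a product of two descending chains.
  shortening-short-short : ∀ r r' y z → suc r ≤ d → suc r' ≤ suc r → Shortening (suc r) (suc r') y z
  shortening-short-short r r' y z le le' with cancel-down (suc r') (suc r) (s≤s z≤n) le' (≤-trans le (n≤1+n d))
  ... | V , der , len = shortening-by-cancellation (suc r) (suc r') y z (down (suc r)) (down₂ r') V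
        (cong₂ _++_ (σ₁-short (suc r) y le) (σ₀-short r' z (≤-trans le' le)))
        (≡⇒∼ (cong (down (suc r) ++_) (sym (down-split r'))) ⟫ der) len

  shortening-middle-b-short : ∀ r' z → suc r' ≤ d → Shortening (suc d) (suc r') cB z
  shortening-middle-b-short r' z le with cancel-down (suc r') (suc d) (s≤s z≤n) (≤-trans le (n≤1+n d)) ≤-refl
  ... | V , der , len = shortening-by-cancellation (suc d) (suc r') cB z (down (suc d)) (down₂ r') V
        (cong₂ _++_ (σ₁-middle cB) (σ₀-short r' z le))
        (≡⇒∼ (cong (down (suc d) ++_) (sym (down-split r'))) ⟫ der) len

  shortening-middle-b-c : Shortening (suc d) (suc d) cB cC
  shortening-middle-b-c with cancel-down (suc d) (suc d) (s≤s z≤n) ≤-refl ≤-refl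
  ... | V , der , len = shortening-by-cancellation (suc d) (suc d) cB cC (down (suc d)) (suc d ∷ down₂ (suc e)) V
        (cong₂ _++_ (σ₁-middle cB) σ₀-middle-c)
        (≡⇒∼ (cong (λ x → down (suc d) ++ suc d ∷ x) (sym (down-split (suc e)))) ⟫ der) len

  shortening-middle-c-short : ∀ r' z → suc r' ≤ d → Shortening (suc d) (suc r') cC z
  shortening-middle-c-short r' z le with cancel-fork (suc r') (s≤s z≤n) (≤-trans le (n≤1+n d))
  ... | V , der , len = shortening-by-cancellation (suc d) (suc r') cC z (n ∷ down d) (down₂ r') V
        (cong₂ _++_ (σ₁-middle cC) (σ₀-short r' z le))
        (≡⇒∼ (cong₂ _++_ (sym downVia-fork-top) (trans (sym (down-split r')) (sym (downVia-fork (suc r') le)))) ⟫ der) len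

  shortening-middle-c-b : Shortening (suc d) (suc d) cC cB
  shortening-middle-c-b with cancel-fork (suc d) (s≤s z≤n) ≤-refl
  ... | V , der , len = shortening-by-cancellation (suc d) (suc d) cC cB (n ∷ down d) (n ∷ down₂ (suc e)) V
        (cong₂ _++_ (σ₁-middle cC) σ₀-middle-b)
        (≡⇒∼ (cong₂ _++_ (sym downVia-fork-top) (trans (cong (n ∷_) (sym (down-split (suc e)))) (sym downVia-fork-top))) ⟫ der) len

  length-up-snoc : ∀ a t x → length (up a t ++ x ∷ []) ≡ t + 1
  length-up-snoc a t x = trans (length-++ (up a t)) (cong (_+ 1) (length-up a t))

  long-length-arith : ∀ t v k → v + 2 ≡ suc d + k → (t + 1) + v + 2 ≡ (n + t) + k
  long-length-arith t v k h = trans (ℕP.+-assoc (t + 1) v 2) (trans (cong (λ x → t + 1 + x) h) (lem t d k))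
    where
    lem : ∀ t d k → t + 1 + (suc d + k) ≡ suc (suc d) + t + k
    lem = NS.solve-∀

  -- The failing cases with j ≥ n and k ≤ n-1: after moving s_{n-1} of σ₁(j) to
  -- the left, the rest is a product of two descending chains.
  shortening-long-fork : ∀ r t y k z P → r + t ≡ d → σ₀ n k z ≡ P ++ 0 ∷ [] → 1 ≤ k → k ≤ suc d → P ++ 1 ∷ [] ≡ downVia forkLetter k → Shortening (n + t) k y z
  shortening-long-fork r t y k z P rt eσ 1k kL eP with cancel-fork k 1k kL
  ... | V , der , len = shortening-by-cancellation (n + t) k y z (longSegment r t) P (U1 ++ V)
        (cong₂ _++_ (σ₁-long r t y rt) eσ)
        (≡⇒∼ (trans (cong₂ _++_ (sym (++-assoc (up (suc r) t) (suc d ∷ []) (n ∷ down d))) eP)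
                (trans (++-assoc U1 (n ∷ down d) (downVia forkLetter k)) (cong (λ x → U1 ++ x ++ downVia forkLetter k) (sym downVia-fork-top))))
          ⟫ ∼-congˡ U1 der)
        (trans (cong (_+ 2) (trans (length-++ U1) (cong (_+ length V) (length-up-snoc (suc r) t (suc d))))) (long-length-arith t (length V) k len))
    where
    U1 = up (suc r) t ++ suc d ∷ []

  shortening-long-short : ∀ r t y r' z → r + t ≡ d → suc r' ≤ d → Shortening (n + t) (suc r') y z
  shortening-long-short r t y r' z rt le = shortening-long-fork r t y (suc r') z (down₂ r') rt (σ₀-short r' z le) (s≤s z≤n) (≤-trans le (n≤1+n d))
                           (trans (sym (down-split r')) (sym (downVia-fork (suc r') le)))

  shortening-long-middle-b : ∀ r t y → r + t ≡ d → Shortening (n + t) (suc d) y cB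
  shortening-long-middle-b r t y rt = shortening-long-fork r t y (suc d) cB (n ∷ down₂ (suc e)) rt σ₀-middle-b (s≤s z≤n) ≤-refl
                   (trans (cong (n ∷_) (sym (down-split (suc e)))) (sym downVia-fork-top))

  shortening-long-middle-c : ∀ r t y → r + t ≡ d → Shortening (n + t) (suc d) y cC
  shortening-long-middle-c r t y rt with cancel-down (suc d) (suc d) (s≤s z≤n) ≤-refl ≤-refl
  ... | V , der , len = shortening-by-cancellation (n + t) (suc d) y cC (longSegment r t) (suc d ∷ down₂ (suc e)) (U1 ++ V)
        (cong₂ _++_ (σ₁-long r t y rt) σ₀-middle-c)
        (≡⇒∼ (cong (λ x → longSegment r t ++ suc d ∷ x) (sym (down-split (suc e))))
          ⟫ ∼-congʳ (down (suc d)) (longSegment-swap-fork r t)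
          ⟫ ≡⇒∼ (trans (cong (_++ down (suc d)) (sym (++-assoc (up (suc r) t) (n ∷ []) (down (suc d))))) (++-assoc U1 (down (suc d)) (down (suc d))))
          ⟫ ∼-congˡ U1 der)
        (trans (cong (_+ 2) (trans (length-++ U1) (cong (_+ length V) (length-up-snoc (suc r) t n)))) (long-length-arith t (length V) (suc d) len))
    where
    U1 = up (suc r) t ++ n ∷ []

  -- The failing case n ≤ k < j: the ascending part of σ₀(k) passes through
  -- σ₁(j), which then absorbs sₙ and leaves a product of two descending chains.
  longSegment-commute-word : ∀ r t W → r + t ≡ d → All (λ i → (suc r < i) × (i ≤ d)) W → (longSegment r t ++ W) ∼ (W ++ longSegment r t)
  longSegment-commute-word r t [] rt [] = ≡⇒∼ (++-identityʳ _)
  longSegment-commute-word r t (i ∷ W) rt ((p , q) ∷ ps) =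
      ≡⇒∼ (sym (++-assoc (longSegment r t) (i ∷ []) W))
    ⟫ ∼-congʳ W (longSegment-commute r t i rt p q)
    ⟫ ∼-congˡ (i ∷ []) (longSegment-commute-word r t W rt ps)

  reassoc-tail : ∀ U (b : ℕ) D → (U ++ b ∷ D) ++ D ≡ (U ++ b ∷ []) ++ (D ++ D)
  reassoc-tail [] b D = refl
  reassoc-tail (u ∷ U) b D = cong (u ∷_) (reassoc-tail U b D)

  reassoc-long : ∀ W (a : ℕ) U b D → W ++ ((a ∷ (U ++ b ∷ D)) ++ D) ≡ (W ++ a ∷ U ++ b ∷ []) ++ (D ++ D)
  reassoc-long [] a U b D = cong (a ∷_) (reassoc-tail U b D)
  reassoc-long (w ∷ W) a U b D = cong (w ∷_) (reassoc-long W a U b D)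

  shortening-long-long : ∀ r t r' t' y z → r + t ≡ d → r' + t' ≡ d → t' < t → Shortening (n + t) (n + t') y z
  shortening-long-long r (suc t'') r' t' y z rt rt' (s≤s t'le) with cancel-down (suc d) (suc d) (s≤s z≤n) ≤-refl ≤-refl
  ... | V , der , len = shortening-by-cancellation (n + t) (n + t') y z (longSegment r t) (W ++ Q) (U2 ++ V)
        (cong₂ _++_ (σ₁-long r t y rt) (trans (σ₀-long r' t' z rt' 1r') (sym (++-assoc W Q (0 ∷ [])))))
        (≡⇒∼ regroup
          ⟫ ∼-congʳ R (longSegment-commute-word r t W rt allW)
          ⟫ ≡⇒∼ (trans (++-assoc W (longSegment r t) R) (cong (W ++_) (sym (++-assoc (longSegment r t) (n ∷ []) (down (suc d))))))
          ⟫ ∼-congˡ W (∼-congʳ (down (suc d)) (longSegment-absorb-n r t'' rt))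
          ⟫ ∼-congˡ W (∼-congʳ (down (suc d)) (∼-congˡ (suc d ∷ []) (longSegment-swap-fork r t)))
          ⟫ ≡⇒∼ (reassoc-long W (suc d) (up (suc r) t) n (down (suc d)))
          ⟫ ∼-congˡ U2 der)
        length-ok
    where
    t = suc t''
    W = up (suc r') t'
    Q = n ∷ suc d ∷ down₂ (suc e)
    R = n ∷ down (suc d)
    U2 = W ++ suc d ∷ up (suc r) t ++ n ∷ []
    r<r' : suc r ≤ r'
    r<r' = ℕP.+-cancelʳ-≤ t' (suc r) r' (≤-trans (ℕP.+-monoʳ-≤ (suc r) t'le) (≤-reflexive (trans (sym (+-suc r t'')) (trans rt (sym rt')))))
    1r' : 1 ≤ r'
    1r' = ≤-trans (s≤s z≤n) r<r'
    allW : All (λ i → (suc r < i) × (i ≤ d)) W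
    allW = all-up (suc r') t' (λ w rw wt → ≤-trans (s≤s r<r') rw , ℕP.≤-pred (subst (w <_) (cong suc rt') wt))
    regroup : longSegment r t ++ (W ++ Q) ++ 1 ∷ [] ≡ (longSegment r t ++ W) ++ R
    regroup = trans (cong (longSegment r t ++_) (trans (++-assoc W Q (1 ∷ [])) (cong (λ x → W ++ n ∷ suc d ∷ x) (sym (down-split (suc e))))))
               (sym (++-assoc (longSegment r t) W R))
    length-ok : length (U2 ++ V) + 2 ≡ (n + t) + (n + t')
    length-ok = trans (cong (_+ 2) (trans (length-++ U2) (cong (_+ length V)
               (trans (length-++ W) (cong₂ _+_ (length-up (suc r') t') (cong suc (length-up-snoc (suc r) t n)))))))
              (trans (ℕP.+-assoc (t' + suc (t + 1)) (length V) 2) (trans (cong (λ x → t' + suc (t + 1) + x) len) (arith t t' d)))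
      where
      arith : ∀ t t' d → t' + suc (t + 1) + (suc d + suc d) ≡ suc (suc d) + t + (suc (suc d) + t')
      arith = NS.solve-∀

  MidLetter : ℕ → Set
  MidLetter i = (1 ≤ i) × (i ≤ suc d)

  act≡actSym : ∀ w q → All MidLetter w → act n w q ≡ actSym w q
  act≡actSym [] q [] = refl
  act≡actSym (suc p ∷ w) q ((_ , le) ∷ ps) = trans (generator-mid p (act n w q) le) (cong (applyAt p exchange) (act≡actSym w q ps))

  mid-down : ∀ t → t ≤ suc d → All MidLetter (down t)
  mid-down zero _ = []
  mid-down (suc t) le = (s≤s z≤n , le) ∷ mid-down t (≤-trans (n≤1+n t) le)

  mid-down₂ : ∀ t → suc t ≤ suc d → All MidLetter (down₂ t)
  mid-down₂ zero _ = []
  mid-down₂ (suc t) le = (s≤s z≤n , le) ∷ mid-down₂ t (≤-trans (n≤1+n _) le)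

  mid-up : ∀ a t → 1 ≤ a → a + t ≤ suc d → All MidLetter (up a t)
  mid-up a zero _ _ = []
  mid-up a (suc t) 1a le = (1a , ≤-trans (ℕP.m≤m+n a (suc t)) le) ∷ mid-up (suc a) t (s≤s z≤n) (subst (_≤ suc d) (+-suc a t) le)

  -- The point σ₀(k)·0 for k ≤ n-2 is (1, 0, …, 0, 1, 0, …, 0), the second 1 in position k + 1.
  depth-one-one : ∀ m → depth (oneℤ ∷ oneℤ ∷ zeros m) ≡ 1
  depth-one-one m = trans (depth-reflect₀ zeroℤ zeroℤ (zeros m) (0 , refl)) (cong suc (depth-zeros (suc (suc m))))

  short-zero-image : ∀ r' s → r' + s ≡ d → act n (down₂ r' ++ 0 ∷ []) (zeros n) ≡ oneℤ ∷ zeros r' ++ oneℤ ∷ zeros s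
  short-zero-image r' s rs = trans (act-++ n (down₂ r') (0 ∷ []) (zeros n))
     (trans (act≡actSym (down₂ r') (oneℤ ∷ oneℤ ∷ zeros d) (mid-down₂ r' (s≤s (≤-trans (ℕP.m≤m+n r' s) (≤-reflexive rs)))))
     (trans (actSym-shift (down r') oneℤ (oneℤ ∷ zeros d) (down-positive r'))
       (cong (oneℤ ∷_) (trans (cong (λ v → actSym (down r') (oneℤ ∷ v)) (trans (cong zeros (sym rs)) (zeros-++ r' s))) (rotate-right′ (zeros r') oneℤ (zeros s) r' (length-zeros r'))))))

  depth-short-zero-image : ∀ r' s → r' + s ≡ d → depth (oneℤ ∷ zeros r' ++ oneℤ ∷ zeros s) ≡ suc r'
  depth-short-zero-image r' s rs = trans (depth-insert oneℤ (zeros r') oneℤ (zeros s) (all-zeros r' (0 , refl)))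
     (trans (cong (λ v → length (zeros r') + depth (oneℤ ∷ oneℤ ∷ v)) (sym (zeros-++ r' s))) (trans (cong₂ _+_ (length-zeros r') (depth-one-one (r' + s))) (+-comm r' 1)))

  applyAt-++′ : ∀ A x y B f p → length A ≡ p → applyAt p f (A ++ x ∷ y ∷ B) ≡ A ++ proj₁ (f x y) ∷ proj₂ (f x y) ∷ B
  applyAt-++′ A x y B f p refl = applyAt-++ A x y B f

  -- The points reached along σ₀(n-2), σ₀ᶜ(n-1) = s_{n-1} σ₀(n-2), σ₀ᵇ(n-1) = sₙ σ₀(n-2),
  -- and sₙ s_{n-1} σ₀(n-2), which starts every long 0-segment; each step crosses a wall.
  prefix₀ : List ℤ
  prefix₀ = oneℤ ∷ zeros (suc e)

  length-prefix₀ : length prefix₀ ≡ d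
  length-prefix₀ = cong suc (length-zeros (suc e))

  q-short q-middle-c q-fork : List ℤ
  q-short = prefix₀ ++ oneℤ ∷ zeroℤ ∷ []
  q-middle-c = prefix₀ ++ zeroℤ ∷ oneℤ ∷ []
  q-fork = prefix₀ ++ negOneℤ ∷ zeroℤ ∷ []

  n-3+1≡n-2 : suc e + 1 ≡ d
  n-3+1≡n-2 = +-comm (suc e) 1

  image-q-short : act n (down₂ (suc e) ++ 0 ∷ []) (zeros n) ≡ q-short
  image-q-short = short-zero-image (suc e) 1 n-3+1≡n-2

  depth-q-short : depth q-short ≡ d
  depth-q-short = depth-short-zero-image (suc e) 1 n-3+1≡n-2

  image-q-middle-c : act n (suc d ∷ down₂ (suc e) ++ 0 ∷ []) (zeros n) ≡ q-middle-c
  image-q-middle-c = trans (cong (generator n (suc d)) image-q-short) (trans (generator-mid d q-short ≤-refl) (applyAt-++′ prefix₀ oneℤ zeroℤ [] exchange d length-prefix₀))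

  depth-q-middle-c : depth q-middle-c ≡ suc d
  depth-q-middle-c = trans (depth-exchange prefix₀ oneℤ zeroℤ [] (0 , refl)) (cong suc depth-q-short)

  q-middle-b : List ℤ
  q-middle-b = prefix₀ ++ zeroℤ ∷ negOneℤ ∷ []

  image-q-middle-b : act n (n ∷ down₂ (suc e) ++ 0 ∷ []) (zeros n) ≡ q-middle-b
  image-q-middle-b = trans (cong (generator n n) image-q-short) (trans (generator-n q-short) (applyAt-++′ prefix₀ oneℤ zeroℤ [] reflectₙ d length-prefix₀))

  depth-q-middle-b : depth q-middle-b ≡ suc d
  depth-q-middle-b = trans (depth-reflectₙ prefix₀ oneℤ zeroℤ 0 refl) (cong suc depth-q-short)

  image-q-fork : act n (n ∷ suc d ∷ down₂ (suc e) ++ 0 ∷ []) (zeros n) ≡ q-fork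
  image-q-fork = trans (cong (generator n n) image-q-middle-c) (trans (generator-n q-middle-c) (applyAt-++′ prefix₀ zeroℤ oneℤ [] reflectₙ d length-prefix₀))

  depth-q-fork : depth q-fork ≡ n
  depth-q-fork = trans (depth-reflectₙ prefix₀ zeroℤ oneℤ 0 refl) (cong suc depth-q-middle-c)

  ZeroSegmentPoint : ℕ → Color → List ℤ → Set
  ZeroSegmentPoint k z q = (act n (σ₀ n k z) (zeros n) ≡ q) × (depth q ≡ k)

  σ₀-short-point : ∀ r' s z → r' + s ≡ d → suc r' ≤ d → ZeroSegmentPoint (suc r') z (oneℤ ∷ zeros r' ++ oneℤ ∷ zeros s)
  σ₀-short-point r' s z rs le = trans (cong (λ w → act n w (zeros n)) (σ₀-short r' z le)) (short-zero-image r' s rs) , depth-short-zero-image r' s rs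

  σ₀-middle-b-point : ZeroSegmentPoint (suc d) cB q-middle-b
  σ₀-middle-b-point = trans (cong (λ w → act n w (zeros n)) σ₀-middle-b) image-q-middle-b , depth-q-middle-b

  σ₀-middle-c-point : ZeroSegmentPoint (suc d) cC q-middle-c
  σ₀-middle-c-point = trans (cong (λ w → act n w (zeros n)) σ₀-middle-c) image-q-middle-c , depth-q-middle-c

  -- A long 0-segment moves the entry -1 of the fork point to the left; the longest
  -- one then applies s₀.
  forkTail : Word
  forkTail = n ∷ suc d ∷ down₂ (suc e) ++ 0 ∷ []

  prefix₀-split : ∀ r t → r + t ≡ suc e → prefix₀ ≡ (oneℤ ∷ zeros r) ++ zeros t
  prefix₀-split r t rt = cong (oneℤ ∷_) (trans (cong zeros (sym rt)) (zeros-++ r t))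

  σ₀-long-point : ∀ r t z → suc r + t ≡ d → ZeroSegmentPoint (n + t) z (oneℤ ∷ zeros r ++ negOneℤ ∷ zeros t ++ zeroℤ ∷ [])
  σ₀-long-point r t z rt = P , depth-q
    where
    rt' : r + t ≡ suc e
    rt' = ℕP.suc-injective rt
    C = oneℤ ∷ zeros r
    lenC : length C ≡ suc r
    lenC = cong suc (length-zeros r)
    v3≡ : q-fork ≡ C ++ zeros t ++ negOneℤ ∷ zeroℤ ∷ []
    v3≡ = trans (cong (_++ negOneℤ ∷ zeroℤ ∷ []) (prefix₀-split r t rt')) (++-assoc C (zeros t) _)
    P : act n (σ₀ n (n + t) z) (zeros n) ≡ oneℤ ∷ zeros r ++ negOneℤ ∷ zeros t ++ zeroℤ ∷ []
    P = trans (cong (λ w → act n w (zeros n)) (σ₀-long (suc r) t z rt (s≤s z≤n)))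
        (trans (act-++ n (up (suc (suc r)) t) forkTail (zeros n))
        (trans (cong (act n (up (suc (suc r)) t)) image-q-fork)
        (trans (act≡actSym (up (suc (suc r)) t) q-fork (mid-up (suc (suc r)) t (s≤s z≤n) (≤-reflexive (cong suc rt))))
        (trans (cong₂ (λ a b → actSym (up (suc a) b) q-fork) (sym lenC) (sym (length-zeros t)))
        (trans (cong (actSym (up (suc (length C)) (length (zeros t)))) v3≡)
        (rotate-left C (zeros t) negOneℤ (zeroℤ ∷ [])))))))
    depth-q : depth (oneℤ ∷ zeros r ++ negOneℤ ∷ zeros t ++ zeroℤ ∷ []) ≡ n + t
    depth-q = trans (depth-rotate-left C (zeros t) negOneℤ (zeroℤ ∷ []) (all-zeros t (0 , refl)))
          (trans (cong₂ _+_ (length-zeros t) (trans (cong depth (sym v3≡)) depth-q-fork)) (+-comm t n))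

  q-longest : List ℤ
  q-longest = twoℤ ∷ zeroℤ ∷ zeros (suc e) ++ zeroℤ ∷ []

  σ₀-longest-point : ∀ z → ZeroSegmentPoint (n + d) z q-longest
  σ₀-longest-point z = P , depth-q
    where
    v3≡ : q-fork ≡ (oneℤ ∷ []) ++ zeros (suc e) ++ negOneℤ ∷ zeroℤ ∷ []
    v3≡ = refl
    R = zeros (suc e) ++ zeroℤ ∷ []
    mid : act n (up 2 (suc e) ++ forkTail) (zeros n) ≡ oneℤ ∷ negOneℤ ∷ R
    mid = trans (act-++ n (up 2 (suc e)) forkTail (zeros n))
          (trans (cong (act n (up 2 (suc e))) image-q-fork)
          (trans (act≡actSym (up 2 (suc e)) q-fork (mid-up 2 (suc e) (s≤s z≤n) ≤-refl))
          (trans (cong (λ b → actSym (up 2 b) q-fork) (sym (length-zeros (suc e))))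
          (rotate-left (oneℤ ∷ []) (zeros (suc e)) negOneℤ (zeroℤ ∷ [])))))
    P : act n (σ₀ n (n + d) z) (zeros n) ≡ q-longest
    P = trans (cong (λ w → act n w (zeros n)) (σ₀-longest z)) (cong (generator n 0) mid)
    depth-q : depth q-longest ≡ n + d
    depth-q = trans (depth-reflect₀ oneℤ negOneℤ R (0 , refl))
          (cong suc (trans (depth-rotate-left (oneℤ ∷ []) (zeros (suc e)) negOneℤ (zeroℤ ∷ []) (all-zeros (suc e) (0 , refl)))
             (trans (cong₂ _+_ (length-zeros (suc e)) depth-q-fork) (arith e))))
      where
      arith : ∀ e → suc e + suc (suc (suc (suc e))) ≡ suc (suc (suc (e + suc (suc e))))
      arith = NS.solve-∀

  -- Applying σ₁(j) to a point x ∷ L moves x rightwards; if x exceeds the entries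
  -- it passes (and, for the long segments, is reflected through the fork and moved
  -- back), every step crosses a wall.
  depth-down-image : ∀ j x L → j ≤ length L → j ≤ suc d → All (Exceeds x) (take j L) → depth (act n (down j) (x ∷ L)) ≡ j + depth (x ∷ L)
  depth-down-image j x L jL jd allp = begin
      depth (act n (down j) (x ∷ L)) ≡⟨ cong depth (trans (act≡actSym (down j) (x ∷ L) (mid-down j jd)) (cong (λ v → actSym (down j) (x ∷ v)) (sym (take++drop≡id j L)))) ⟩
      depth (actSym (down j) (x ∷ take j L ++ drop j L)) ≡⟨ cong depth (rotate-right′ (take j L) x (drop j L) j lenT) ⟩
      depth (take j L ++ x ∷ drop j L) ≡⟨ depth-rotate-right (take j L) x (drop j L) allp ⟩
      length (take j L) + depth (x ∷ take j L ++ drop j L) ≡⟨ cong₂ (λ a b → a + depth (x ∷ b)) lenT (take++drop≡id j L) ⟩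
      j + depth (x ∷ L) ∎
    where
    open ≡-Reasoning
    lenT : length (take j L) ≡ j
    lenT = trans (length-take j L) (ℕP.m≤n⇒m⊓n≡m jL)

  depth-fork-image : ∀ x A l m → length A ≡ d → All (Exceeds x) A → x ⊕ l ≡ + suc m → depth (act n (n ∷ down d) (x ∷ A ++ l ∷ [])) ≡ suc d + depth (x ∷ A ++ l ∷ [])
  depth-fork-image x A l m lenA allp pos = begin
      depth (generator n n (act n (down d) (x ∷ A ++ l ∷ []))) ≡⟨ cong depth (trans (generator-n _) (cong (applyAt d reflectₙ) (trans (act≡actSym (down d) _ (mid-down d (n≤1+n d))) (rotate-right′ A x (l ∷ []) d lenA)))) ⟩
      depth (applyAt d reflectₙ (A ++ x ∷ l ∷ [])) ≡⟨ cong depth (applyAt-++′ A x l [] reflectₙ d lenA) ⟩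
      depth (A ++ - l ∷ - x ∷ []) ≡⟨ depth-reflectₙ A x l m pos ⟩
      suc (depth (A ++ x ∷ l ∷ [])) ≡⟨ cong suc (depth-rotate-right A x (l ∷ []) allp) ⟩
      suc (length A + depth (x ∷ A ++ l ∷ [])) ≡⟨ cong (λ a → suc (a + depth (x ∷ A ++ l ∷ []))) lenA ⟩
      suc d + depth (x ∷ A ++ l ∷ []) ∎
    where open ≡-Reasoning

  depth-long-image : ∀ m C A r t → length C ≡ r → length A ≡ t → r + t ≡ d → All (Exceeds (+ suc m)) (C ++ A) → All (λ a → Exceeds a (- (+ suc m))) A →
         depth (act n (longSegment r t) (+ suc m ∷ (C ++ A) ++ zeroℤ ∷ [])) ≡ (n + t) + depth (+ suc m ∷ (C ++ A) ++ zeroℤ ∷ [])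
  depth-long-image m C A r t lenC lenA rt allCA allA = begin
      depth (act n (longSegment r t) q) ≡⟨ cong depth (act-++ n (up (suc r) t) (suc d ∷ n ∷ down d) q) ⟩
      depth (act n (up (suc r) t) (generator n (suc d) (generator n n (act n (down d) q)))) ≡⟨ cong (λ v → depth (act n (up (suc r) t) v)) fork-steps ⟩
      depth (act n (up (suc r) t) (C ++ A ++ - x ∷ zeroℤ ∷ [])) ≡⟨ cong depth (act≡actSym (up (suc r) t) _ (mid-up (suc r) t (s≤s z≤n) (≤-reflexive (cong suc rt)))) ⟩
      depth (actSym (up (suc r) t) (C ++ A ++ - x ∷ zeroℤ ∷ [])) ≡⟨ cong (λ p → depth (actSym (up (suc (proj₁ p)) (proj₂ p)) (C ++ A ++ - x ∷ zeroℤ ∷ []))) (cong₂ _,_ (sym lenC) (sym lenA)) ⟩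
      depth (actSym (up (suc (length C)) (length A)) (C ++ A ++ - x ∷ zeroℤ ∷ [])) ≡⟨ cong depth (rotate-left C A (- x) (zeroℤ ∷ [])) ⟩
      depth (C ++ - x ∷ A ++ zeroℤ ∷ []) ≡⟨ depth-rotate-left C A (- x) (zeroℤ ∷ []) allA ⟩
      length A + depth (C ++ A ++ - x ∷ zeroℤ ∷ []) ≡⟨ cong₂ _+_ lenA (cong depth (sym (++-assoc C A _))) ⟩
      t + depth (CA ++ - x ∷ zeroℤ ∷ []) ≡⟨ cong (λ v → t + v) (depth-exchange CA zeroℤ (- x) [] (m , refl)) ⟩
      t + suc (depth (CA ++ zeroℤ ∷ - x ∷ [])) ≡⟨ cong (λ v → t + suc v) (depth-reflectₙ CA x zeroℤ m (cong (λ y → + suc y) (ℕP.+-identityʳ m))) ⟩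
      t + suc (suc (depth (CA ++ x ∷ zeroℤ ∷ []))) ≡⟨ cong (λ v → t + suc (suc v)) (depth-rotate-right CA x (zeroℤ ∷ []) allCA) ⟩
      t + suc (suc (length CA + depth q)) ≡⟨ cong (λ v → t + suc (suc (v + depth q))) lenCA ⟩
      t + suc (suc (d + depth q)) ≡⟨ arith t d (depth q) ⟩
      (n + t) + depth q ∎
    where
    open ≡-Reasoning
    x = + suc m
    CA = C ++ A
    q = x ∷ CA ++ zeroℤ ∷ []
    lenCA : length CA ≡ d
    lenCA = trans (length-++ C) (trans (cong₂ _+_ lenC lenA) rt)
    fork-steps : generator n (suc d) (generator n n (act n (down d) q)) ≡ C ++ A ++ - x ∷ zeroℤ ∷ []
    fork-steps = trans (generator-mid d _ ≤-refl) (trans (cong (applyAt d exchange) (trans (generator-n _) (cong (applyAt d reflectₙ) (trans (act≡actSym (down d) q (mid-down d (n≤1+n d))) (rotate-right′ CA x (zeroℤ ∷ []) d lenCA)))))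
             (trans (cong (applyAt d exchange) (applyAt-++′ CA x zeroℤ [] reflectₙ d lenCA)) (trans (applyAt-++′ CA zeroℤ (- x) [] exchange d lenCA) (++-assoc C A _))))
    arith : ∀ t d k → t + suc (suc (d + k)) ≡ suc (suc d) + t + k
    arith = NS.solve-∀

  product : ℕ → ℕ → Color → Color → Word
  product j k y z = σ₁ n j y ++ σ₀ n k z

  depth-product : ∀ j k y z q → ZeroSegmentPoint k z q → depth (act n (σ₁ n j y) q) ≡ j + depth q → depth (act n (product j k y z) (zeros n)) ≡ j + k
  depth-product j k y z q (image , depth-q) σ₁-depth = begin
      depth (act n (σ₁ n j y ++ σ₀ n k z) (zeros n)) ≡⟨ cong depth (act-++ n (σ₁ n j y) (σ₀ n k z) (zeros n)) ⟩
      depth (act n (σ₁ n j y) (act n (σ₀ n k z) (zeros n))) ≡⟨ cong (λ p → depth (act n (σ₁ n j y) p)) image ⟩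
      depth (act n (σ₁ n j y) q) ≡⟨ σ₁-depth ⟩
      j + depth q ≡⟨ cong (λ v → j + v) depth-q ⟩
      j + k ∎
    where open ≡-Reasoning

  length-σ₁ : ∀ j y → LengthRange j → length (σ₁ n j y) ≡ j
  length-σ₁ j y (short r refl le) = trans (cong length (σ₁-short (suc r) y le)) (length-down (suc r))
  length-σ₁ j cB (middle refl) = trans (cong length (σ₁-middle cB)) (cong suc (length-down d))
  length-σ₁ j cC (middle refl) = trans (cong length (σ₁-middle cC)) (cong suc (length-down d))
  length-σ₁ j y (long r t refl rt) = trans (cong length (σ₁-long r t y rt))
    (trans (length-++ (up (suc r) t)) (trans (cong₂ _+_ (length-up (suc r) t) (cong (λ x → suc (suc x)) (length-down d))) (+-comm t n)))

  length-product : ∀ j k y z → LengthRange j → LengthRange k → length (product j k y z) ≡ j + k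
  length-product j k y z jv kv = trans (length-++ (σ₁ n j y)) (cong₂ _+_ (length-σ₁ j y jv) (trans (length-map (τ n) (σ₁ n k z)) (length-σ₁ k z kv)))

  FullDepth : ℕ → ℕ → Color → Color → Set
  FullDepth j k y z = depth (act n (product j k y z) (zeros n)) ≡ j + k

  σ₁-short-image : ∀ j y x L → j ≤ d → j ≤ length L → All (Exceeds x) (take j L) → depth (act n (σ₁ n j y) (x ∷ L)) ≡ j + depth (x ∷ L)
  σ₁-short-image j y x L jd jL allp = trans (cong (λ w → depth (act n w (x ∷ L))) (σ₁-short j y jd)) (depth-down-image j x L jL (≤-trans jd (n≤1+n d)) allp)

  σ₁-middle-b-image : ∀ x L → length L ≡ suc d → All (Exceeds x) L → depth (act n (σ₁ n (suc d) cB) (x ∷ L)) ≡ suc d + depth (x ∷ L)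
  σ₁-middle-b-image x L lenL allp = trans (cong (λ w → depth (act n w (x ∷ L))) (σ₁-middle cB))
     (depth-down-image (suc d) x L (≤-reflexive (sym lenL)) ≤-refl (subst (All (Exceeds x)) (sym (take-all (suc d) L (≤-reflexive lenL))) allp))

  σ₁-middle-c-image : ∀ x A l m → length A ≡ d → All (Exceeds x) A → x ⊕ l ≡ + suc m → depth (act n (σ₁ n (suc d) cC) (x ∷ A ++ l ∷ [])) ≡ suc d + depth (x ∷ A ++ l ∷ [])
  σ₁-middle-c-image x A l m lenA allp pos = trans (cong (λ w → depth (act n w (x ∷ A ++ l ∷ []))) (σ₁-middle cC)) (depth-fork-image x A l m lenA allp pos)

  σ₁-long-image : ∀ r t y m C A → length C ≡ r → length A ≡ t → r + t ≡ d → All (Exceeds (+ suc m)) (C ++ A) → All (λ a → Exceeds a (- (+ suc m))) A →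
         depth (act n (σ₁ n (n + t) y) (+ suc m ∷ (C ++ A) ++ zeroℤ ∷ [])) ≡ (n + t) + depth (+ suc m ∷ (C ++ A) ++ zeroℤ ∷ [])
  σ₁-long-image r t y m C A lenC lenA rt allCA allA =
    trans (cong (λ w → depth (act n w (+ suc m ∷ (C ++ A) ++ zeroℤ ∷ []))) (σ₁-long r t y rt)) (depth-long-image m C A r t lenC lenA rt allCA allA)

  tail-long : ℕ → ℕ → List ℤ
  tail-long r'' t' = zeros r'' ++ negOneℤ ∷ zeros t' ++ zeroℤ ∷ []

  length-tail-long : ∀ r'' t' → suc r'' + t' ≡ d → length (tail-long r'' t') ≡ suc d
  length-tail-long r'' t' rt = trans (length-zeros-++ r'' _) (trans (cong (λ x → r'' + suc x) (length-zeros-++ t' (zeroℤ ∷ []))) (trans (arith r'' t') (cong suc rt)))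
    where
    arith : ∀ a b → a + suc (b + 1) ≡ suc (suc a + b)
    arith = NS.solve-∀

  all-tail-long : ∀ r'' t' → All (Exceeds oneℤ) (tail-long r'' t')
  all-tail-long r'' t' = ++⁺ (all-zeros r'' (0 , refl)) ((1 , refl) ∷ ++⁺ (all-zeros t' (0 , refl)) ((0 , refl) ∷ []))

  tail-longest : List ℤ
  tail-longest = zeroℤ ∷ zeros (suc e) ++ zeroℤ ∷ []

  length-tail-longest : length tail-longest ≡ suc d
  length-tail-longest = cong suc (trans (length-zeros-++ (suc e) (zeroℤ ∷ [])) (+-comm (suc e) 1))

  all-tail-longest : ∀ {P : ℤ → Set} → P zeroℤ → All P tail-longest
  all-tail-longest p = p ∷ ++⁺ (all-zeros (suc e) p) (p ∷ [])

  tail-middle : ℤ → List ℤ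
  tail-middle l = zeros (suc e) ++ zeroℤ ∷ l ∷ []

  tail-middle≡ : ∀ l → tail-middle l ≡ zeros d ++ l ∷ []
  tail-middle≡ l = zeros-snoc (suc e) (l ∷ [])

  length-tail-middle : ∀ l → length (tail-middle l) ≡ suc d
  length-tail-middle l = trans (cong length (tail-middle≡ l)) (trans (length-zeros-++ d (l ∷ [])) (+-comm d 1))

  full-short-short : ∀ r r' y z → suc r ≤ d → suc r' ≤ d → r < r' → FullDepth (suc r) (suc r') y z
  full-short-short r r' y z le le' lt = depth-product (suc r) (suc r') y z _ (σ₀-short-point r' s z rs le')
      (σ₁-short-image (suc r) y oneℤ (zeros r' ++ oneℤ ∷ zeros s) le (≤-trans lt (≤-trans (ℕP.m≤m+n r' _) (≤-reflexive (sym (length-zeros-++ r' (oneℤ ∷ zeros s)))))) (all-take-zeros (suc r) r' (oneℤ ∷ zeros s) lt (0 , refl)))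
    where
    s = d ∸ r'
    rs : r' + s ≡ d
    rs = ℕP.m+[n∸m]≡n (≤-trans (n≤1+n r') le')

  full-short-middle : ∀ r y z → suc r ≤ d → FullDepth (suc r) (suc d) y z
  full-short-middle r y cB le = depth-product (suc r) (suc d) y cB _ σ₀-middle-b-point
      (σ₁-short-image (suc r) y oneℤ (tail-middle negOneℤ) le (≤-trans le (≤-trans (n≤1+n d) (≤-reflexive (sym (length-tail-middle negOneℤ))))) (subst (λ L → All (Exceeds oneℤ) (take (suc r) L)) (sym (tail-middle≡ negOneℤ)) (all-take-zeros (suc r) d (negOneℤ ∷ []) le (0 , refl))))
  full-short-middle r y cC le = depth-product (suc r) (suc d) y cC _ σ₀-middle-c-point
      (σ₁-short-image (suc r) y oneℤ (tail-middle oneℤ) le (≤-trans le (≤-trans (n≤1+n d) (≤-reflexive (sym (length-tail-middle oneℤ))))) (subst (λ L → All (Exceeds oneℤ) (take (suc r) L)) (sym (tail-middle≡ oneℤ)) (all-take-zeros (suc r) d (oneℤ ∷ []) le (0 , refl))))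

  full-short-long : ∀ r r'' t' y z → suc r ≤ d → suc r'' + t' ≡ d → FullDepth (suc r) (n + t') y z
  full-short-long r r'' t' y z le rt = depth-product (suc r) (n + t') y z _ (σ₀-long-point r'' t' z rt)
      (σ₁-short-image (suc r) y oneℤ (tail-long r'' t') le (≤-trans le (≤-trans (n≤1+n d) (≤-reflexive (sym (length-tail-long r'' t' rt))))) (take⁺ (suc r) (all-tail-long r'' t')))

  full-short-longest : ∀ r y z → suc r ≤ d → FullDepth (suc r) (n + d) y z
  full-short-longest r y z le = depth-product (suc r) (n + d) y z _ (σ₀-longest-point z)
      (σ₁-short-image (suc r) y twoℤ tail-longest le (≤-trans le (≤-trans (n≤1+n d) (≤-reflexive (sym length-tail-longest)))) (take⁺ (suc r) (all-tail-longest (1 , refl))))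

  full-middle-b-b : FullDepth (suc d) (suc d) cB cB
  full-middle-b-b = depth-product (suc d) (suc d) cB cB _ σ₀-middle-b-point (σ₁-middle-b-image oneℤ (tail-middle negOneℤ) (length-tail-middle negOneℤ) (++⁺ (all-zeros (suc e) (0 , refl)) ((0 , refl) ∷ (1 , refl) ∷ [])))

  full-middle-c-c : FullDepth (suc d) (suc d) cC cC
  full-middle-c-c = depth-product (suc d) (suc d) cC cC _ σ₀-middle-c-point
      (subst (λ L → depth (act n (σ₁ n (suc d) cC) (oneℤ ∷ L)) ≡ suc d + depth (oneℤ ∷ L)) (++-assoc (zeros (suc e)) (zeroℤ ∷ []) (oneℤ ∷ []))
        (σ₁-middle-c-image oneℤ (zeros (suc e) ++ zeroℤ ∷ []) oneℤ 1 (trans (length-zeros-++ (suc e) (zeroℤ ∷ [])) (+-comm (suc e) 1)) (++⁺ (all-zeros (suc e) (0 , refl)) ((0 , refl) ∷ [])) refl))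

  full-middle-b-long : ∀ r'' t' z → suc r'' + t' ≡ d → FullDepth (suc d) (n + t') cB z
  full-middle-b-long r'' t' z rt = depth-product (suc d) (n + t') cB z _ (σ₀-long-point r'' t' z rt) (σ₁-middle-b-image oneℤ (tail-long r'' t') (length-tail-long r'' t' rt) (all-tail-long r'' t'))

  full-middle-b-longest : ∀ z → FullDepth (suc d) (n + d) cB z
  full-middle-b-longest z = depth-product (suc d) (n + d) cB z _ (σ₀-longest-point z) (σ₁-middle-b-image twoℤ tail-longest length-tail-longest (all-tail-longest (1 , refl)))

  full-middle-c-long : ∀ r'' t' z → suc r'' + t' ≡ d → FullDepth (suc d) (n + t') cC z
  full-middle-c-long r'' t' z rt = depth-product (suc d) (n + t') cC z _ (σ₀-long-point r'' t' z rt)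
      (subst (λ L → depth (act n (σ₁ n (suc d) cC) (oneℤ ∷ L)) ≡ suc d + depth (oneℤ ∷ L)) (++-assoc (zeros r'') (negOneℤ ∷ zeros t') (zeroℤ ∷ []))
        (σ₁-middle-c-image oneℤ (zeros r'' ++ negOneℤ ∷ zeros t') zeroℤ 0 lenA (++⁺ (all-zeros r'' (0 , refl)) ((1 , refl) ∷ all-zeros t' (0 , refl))) refl))
    where
    lenA : length (zeros r'' ++ negOneℤ ∷ zeros t') ≡ d
    lenA = trans (length-zeros-++ r'' (negOneℤ ∷ zeros t')) (trans (cong (λ x → r'' + suc x) (length-zeros t')) (trans (+-suc r'' t') rt))

  full-middle-c-longest : ∀ z → FullDepth (suc d) (n + d) cC z
  full-middle-c-longest z = depth-product (suc d) (n + d) cC z _ (σ₀-longest-point z)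
      (σ₁-middle-c-image twoℤ (zeroℤ ∷ zeros (suc e)) zeroℤ 1 (cong suc (length-zeros (suc e))) (all-zeros (suc (suc e)) (1 , refl)) refl)

  full-long-long : ∀ r t r'' t' y z → r + t ≡ d → suc r'' + t' ≡ d → t ≤ t' → FullDepth (n + t) (n + t') y z
  full-long-long r t r'' t' y z rt rt' tt' = depth-product (n + t) (n + t') y z _ (σ₀-long-point r'' t' z rt')
      (subst (λ L → depth (act n (σ₁ n (n + t) y) (oneℤ ∷ L)) ≡ (n + t) + depth (oneℤ ∷ L)) (sym tail-split)
        (σ₁-long-image r t y 0 C (zeros t) lenC (length-zeros t) rt allCA (all-zeros t (0 , refl))))
    where
    u = t' ∸ t
    ut : u + t ≡ t'
    ut = ℕP.m∸n+n≡m tt'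
    C = zeros r'' ++ negOneℤ ∷ zeros u
    tail-split : tail-long r'' t' ≡ (C ++ zeros t) ++ zeroℤ ∷ []
    tail-split = trans (cong (λ v → zeros r'' ++ negOneℤ ∷ v ++ zeroℤ ∷ []) (trans (cong zeros (sym ut)) (zeros-++ u t)))
          (trans (cong (λ v → zeros r'' ++ negOneℤ ∷ v) (++-assoc (zeros u) (zeros t) (zeroℤ ∷ [])))
          (sym (trans (++-assoc C (zeros t) (zeroℤ ∷ [])) (++-assoc (zeros r'') (negOneℤ ∷ zeros u) (zeros t ++ zeroℤ ∷ [])))))
    lenC : length C ≡ r
    lenC = ℕP.+-cancelʳ-≡ t (length C) r (trans (cong (_+ t) (trans (length-zeros-++ r'' (negOneℤ ∷ zeros u)) (cong (λ x → r'' + suc x) (length-zeros u))))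
             (trans (arith r'' u t) (trans (cong (λ x → suc r'' + x) ut) (trans rt' (sym rt)))))
      where
      arith : ∀ a b c → a + suc b + c ≡ suc a + (b + c)
      arith = NS.solve-∀
    allCA : All (Exceeds oneℤ) (C ++ zeros t)
    allCA = ++⁺ (++⁺ (all-zeros r'' (0 , refl)) ((1 , refl) ∷ all-zeros u (0 , refl))) (all-zeros t (0 , refl))

  full-long-longest : ∀ r t y z → r + t ≡ d → FullDepth (n + t) (n + d) y z
  full-long-longest r t y z rt = depth-product (n + t) (n + d) y z _ (σ₀-longest-point z)
      (subst (λ L → depth (act n (σ₁ n (n + t) y) (twoℤ ∷ L)) ≡ (n + t) + depth (twoℤ ∷ L)) (sym tail-split)
        (σ₁-long-image r t y 1 (zeros r) (zeros t) (length-zeros r) (length-zeros t) rt (++⁺ (all-zeros r (1 , refl)) (all-zeros t (1 , refl))) (all-zeros t (1 , refl))))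
    where
    tail-split : tail-longest ≡ (zeros r ++ zeros t) ++ zeroℤ ∷ []
    tail-split = cong (_++ zeroℤ ∷ []) (trans (cong zeros (sym rt)) (zeros-++ r t))

  Admissible : ℕ → ℕ → Color → Color → Set
  Admissible j k y z = ((j < k) ⊎ ((n ∸ 1 ≤ j) × (j ≡ k))) × (j ≡ n ∸ 1 → k ≡ n ∸ 1 → y ≡ z)

  data Verdict (j k : ℕ) (y z : Color) : Set where
    reduced : Admissible j k y z → FullDepth j k y z → Verdict j k y z
    shortened : ¬ Admissible j k y z → Shortening j k y z → Verdict j k y z

  ¬n-1≤n-2 : ¬ (suc d ≤ d)
  ¬n-1≤n-2 le = ℕP.<-irrefl refl le

  ¬long≤n-2 : ∀ t → ¬ (n + t ≤ d)
  ¬long≤n-2 t le = n≰d (≤-trans (ℕP.m≤m+n n t) le)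

  n-1<long : ∀ t → suc d < n + t
  n-1<long t = ℕP.m≤m+n n t

  long≢n-1 : ∀ t → n + t ≢ suc d
  long≢n-1 t eq = ℕP.<-irrefl (sym eq) (n-1<long t)

  ¬admissible-below : ∀ j r' y z → suc d ≤ j → suc r' ≤ d → ¬ Admissible j (suc r') y z
  ¬admissible-below j r' y z n-1≤j le' (inj₁ lt , _) = ¬n-1≤n-2 (≤-trans n-1≤j (≤-trans (ℕP.<⇒≤ lt) le'))
  ¬admissible-below j r' y z n-1≤j le' (inj₂ (_ , refl) , _) = ¬n-1≤n-2 (≤-trans n-1≤j le')

  ¬admissible-long-middle : ∀ t y z → ¬ Admissible (n + t) (suc d) y z
  ¬admissible-long-middle t y z (inj₁ lt , _) = ℕP.<-asym lt (n-1<long t)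
  ¬admissible-long-middle t y z (inj₂ (_ , eq) , _) = long≢n-1 t eq

  b≢c : cB ≢ cC
  b≢c ()

  verdict-short : ∀ r k y z → suc r ≤ d → LengthRange k → Verdict (suc r) k y z
  verdict-short r k y z le (short r' refl le') with <-cmp r r'
  ... | tri< lt _ _ = reduced (inj₁ (s≤s lt) , λ eq _ → ⊥-elim (¬n-1≤n-2 (subst (_≤ d) eq le))) (full-short-short r r' y z le le' lt)
  ... | tri≈ _ refl _ = shortened not-admissible (shortening-short-short r r y z le ≤-refl)
    where
    not-admissible : ¬ Admissible (suc r) (suc r) y z
    not-admissible (inj₁ lt , _) = ℕP.<-irrefl refl lt
    not-admissible (inj₂ (h , _) , _) = ¬n-1≤n-2 (≤-trans h le)
  ... | tri> _ _ gt = shortened not-admissible (shortening-short-short r r' y z le (s≤s (ℕP.<⇒≤ gt)))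
    where
    not-admissible : ¬ Admissible (suc r) (suc r') y z
    not-admissible (inj₁ lt , _) = ℕP.<-asym gt (ℕP.≤-pred lt)
    not-admissible (inj₂ (h , _) , _) = ¬n-1≤n-2 (≤-trans h le)
  verdict-short r k y z le (middle refl) = reduced (inj₁ (s≤s le) , λ eq _ → ⊥-elim (¬n-1≤n-2 (subst (_≤ d) eq le))) (full-short-middle r y z le)
  verdict-short r k y z le (long zero t' refl refl) = reduced (inj₁ (≤-trans (s≤s le) (≤-trans (n≤1+n _) (ℕP.m≤m+n n d))) , λ eq _ → ⊥-elim (¬n-1≤n-2 (subst (_≤ d) eq le))) (full-short-longest r y z le)
  verdict-short r k y z le (long (suc r'') t' refl rt) = reduced (inj₁ (≤-trans (s≤s le) (≤-trans (n≤1+n _) (ℕP.m≤m+n n t'))) , λ eq _ → ⊥-elim (¬n-1≤n-2 (subst (_≤ d) eq le))) (full-short-long r r'' t' y z le rt)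

  verdict-middle : ∀ k y z → LengthRange k → Verdict (suc d) k y z
  verdict-middle k cB z (short r' refl le') = shortened (¬admissible-below (suc d) r' cB z ≤-refl le') (shortening-middle-b-short r' z le')
  verdict-middle k cC z (short r' refl le') = shortened (¬admissible-below (suc d) r' cC z ≤-refl le') (shortening-middle-c-short r' z le')
  verdict-middle k cB cB (middle refl) = reduced (inj₂ (≤-refl , refl) , λ _ _ → refl) full-middle-b-b
  verdict-middle k cC cC (middle refl) = reduced (inj₂ (≤-refl , refl) , λ _ _ → refl) full-middle-c-c
  verdict-middle k cB cC (middle refl) = shortened (λ (_ , same-colour) → b≢c (same-colour refl refl)) shortening-middle-b-c
  verdict-middle k cC cB (middle refl) = shortened (λ (_ , same-colour) → b≢c (sym (same-colour refl refl))) shortening-middle-c-b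
  verdict-middle k cB z (long zero t' refl refl) = reduced (inj₁ (n-1<long d) , λ _ eq → ⊥-elim (long≢n-1 d eq)) (full-middle-b-longest z)
  verdict-middle k cB z (long (suc r'') t' refl rt) = reduced (inj₁ (n-1<long t') , λ _ eq → ⊥-elim (long≢n-1 t' eq)) (full-middle-b-long r'' t' z rt)
  verdict-middle k cC z (long zero t' refl refl) = reduced (inj₁ (n-1<long d) , λ _ eq → ⊥-elim (long≢n-1 d eq)) (full-middle-c-longest z)
  verdict-middle k cC z (long (suc r'') t' refl rt) = reduced (inj₁ (n-1<long t') , λ _ eq → ⊥-elim (long≢n-1 t' eq)) (full-middle-c-long r'' t' z rt)

  verdict-long : ∀ r t k y z → r + t ≡ d → LengthRange k → Verdict (n + t) k y z
  verdict-long r t k y z rt (short r' refl le') = shortened (¬admissible-below (n + t) r' y z (ℕP.<⇒≤ (n-1<long t)) le') (shortening-long-short r t y r' z rt le')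
  verdict-long r t k y cB rt (middle refl) = shortened (¬admissible-long-middle t y cB) (shortening-long-middle-b r t y rt)
  verdict-long r t k y cC rt (middle refl) = shortened (¬admissible-long-middle t y cC) (shortening-long-middle-c r t y rt)
  verdict-long r t k y z rt (long r' t' refl rt') with <-cmp t t'
  ... | tri> _ _ gt = shortened not-admissible (shortening-long-long r t r' t' y z rt rt' gt)
    where
    not-admissible : ¬ Admissible (n + t) (n + t') y z
    not-admissible (inj₁ lt , _) = ℕP.<-asym gt (ℕP.+-cancelˡ-< n t t' lt)
    not-admissible (inj₂ (_ , eq) , _) = ℕP.<-irrefl (ℕP.+-cancelˡ-≡ n t' t (sym eq)) gt
  ... | tri< lt _ _ = reduced (inj₁ (ℕP.+-monoʳ-< n lt) , λ eq _ → ⊥-elim (long≢n-1 t eq)) (full-long r' t' rt' (ℕP.<⇒≤ lt))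
    where
    full-long : ∀ r' t' → r' + t' ≡ d → t ≤ t' → FullDepth (n + t) (n + t') y z
    full-long zero t' refl _ = full-long-longest r t y z rt
    full-long (suc r'') t' rt' tt' = full-long-long r t r'' t' y z rt rt' tt'
  ... | tri≈ _ refl _ = reduced (inj₂ (ℕP.<⇒≤ (n-1<long t) , refl) , λ eq _ → ⊥-elim (long≢n-1 t eq)) (full-long r' rt')
    where
    full-long : ∀ r' → r' + t ≡ d → FullDepth (n + t) (n + t) y z
    full-long zero refl = full-long-longest r t y z rt
    full-long (suc r'') rt' = full-long-long r t r'' t y z rt rt' ≤-refl

  verdict : ∀ j k y z → LengthRange j → LengthRange k → Verdict j k y z
  verdict j k y z (short r refl le) range-k = verdict-short r k y z le range-k
  verdict j k y z (middle refl) range-k = verdict-middle k y z range-k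
  verdict j k y z (long r t refl rt) range-k = verdict-long r t k y z rt range-k

corollary7p5 : ∀ (n : ℕ) → 4 ≤ n →
    ∀ (j k : ℕ) → 1 ≤ j → j ≤ 2 * n ∸ 2 → 1 ≤ k → k ≤ 2 * n ∸ 2 →
    ∀ (y z : Color) →
    (InWS n (σ₁ n j y ++ σ₀ n k z) × HasLength n (σ₁ n j y ++ σ₀ n k z) (j + k))
    ⇔ (((j < k) ⊎ ((n ∸ 1 ≤ j) × (j ≡ k))) × (j ≡ n ∸ 1 → k ≡ n ∸ 1 → y ≡ z))
corollary7p5 _ (s≤s (s≤s (s≤s (s≤s {n = e} z≤n)))) j k 1≤j j≤2n-2 1≤k k≤2n-2 y z
  with AffineD.lengthRange e j 1≤j j≤2n-2 | AffineD.lengthRange e k 1≤k k≤2n-2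
... | range-j | range-k with AffineD.verdict e j k y z range-j range-k
...   | AffineD.reduced admissible full-depth =
        mk⇔ (λ _ → admissible) (λ _ → AffineD.full-depth-minimal e (AffineD.product e j k y z) (j + k) full-depth (AffineD.length-product e j k y z range-j range-k))
...   | AffineD.shortened ¬admissible shortening =
        mk⇔ (λ (inWS , length-j+k) → ⊥-elim (AffineD.shortening-refutes e j k y z shortening inWS length-j+k)) (λ admissible → ⊥-elim (¬admissible admissible))
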